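{- Let $n\ge1$. The map $\Phi_F$ is a bijection from the set of recurrent configurations on the fan graph $F_n$ to the set of properly-marked $\{L,R\}$-words of length $n-1$. Moreover, for every recurrent configuration $c$ on $F_n$, $\mathrm{level}(c)$ equals the number of marked elements (occurrences of $L^m$) in $\Phi_F(c)$.
   Context: The fan graph $F_n$ has vertex set $\{0,\dots,n\}$, edges $\{i,i+1\}$ ($i\in[n-1]$) and $\{0,i\}$ ($i\in[n]$); $0$ is the sink. Abelian sandpile model: a configuration is $c\in\mathbb{Z}_{\ge0}^n$, stable if $c_i<\deg(i)$ for all $i$. Toppling an unstable $i$ removes $\deg(i)$ grains from $i$ and gives one to each neighbour (grains sent to $0$ are lost); repeated toppling gives a unique stabilisation. With a distribution $\mu$ on $[n]$, all $\mu_i>0$, the Markov chain on stable configurations adds a grain at $i$ with probability $\mu_i$ and stabilises; recurrent configurations are its recurrent states. The level of $c$ is $\sum_ic_i+\deg(0)-|E(F_n)|=\sum_ic_i-n+1$. The map $\Phi_F$: for recurrent $c$, orient the edges $\{i,i+1\}$, $0\le i\le n-1$, of the path on vertices $0,1,\dots,n$ and mark vertices as follows. Orient $1\to0$. For $i=1,\dots,n-1$, given the orientation of $\{i-1,i\}$: if it is $i\to i-1$, orient $i\to i+1$ when $c_i=0$, and otherwise orient $i+1\to i$ and mark $i$ if $c_i=2$; if it is $i-1\to i$, orient $i\to i+1$ when $c_i=1$ and $i+1\to i$ when $c_i=2$ (the case $c_i=0$ does not occur for recurrent $c$). Mark $n$ if $\{n-1,n\}$ is oriented $n\to n-1$ and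 $c_n=1$. Then $\Phi_F(c)=w_1\cdots w_{n-1}$ with $w_i=R$ if $i\to i+1$, $w_i=L^m$ if $i+1\to i$ and $i+1$ is marked, $w_i=L^u$ if $i+1\to i$ and $i+1$ is unmarked. A properly-marked $\{L,R\}$-word is a word over $\{L^u,L^m,R\}$ in which every $L^m$ is the last letter or is immediately followed by $L^u$ or $L^m$; occurrences of $L^m$ are marked elements, of $L^u$ unmarked elements. -}

module Defs where

open import Data.Nat using (ℕ; zero; suc; _+_; _<_; _≤_; _∸_)
open import Data.Nat.Properties using (_<?_)
open import Data.Integer using (ℤ; +_; _-_) renaming (_+_ to _+ℤ_)
open import Data.Fin using (Fin; toℕ)
open import Data.Fin.Properties using () renaming (_≟_ to _≟ᶠ_)
open import Data.List using (List; []; _∷_; length; filter)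
open import Data.List.Base using (allFin)
open import Data.Vec using (Vec; lookup; tabulate; toList; _[_]%=_)
open import Data.Product using (Σ; _×_)
open import Data.Sum using (_⊎_)
open import Data.Bool using (Bool; true; false; if_then_else_)
open import Relation.Nullary using (Dec; yes; no; ⌊_⌋)
open import Relation.Binary.PropositionalEquality using (_≡_)
open import Relation.Binary.Construct.Closure.ReflexiveTransitive using (Star)
import Data.Nat as ℕ
open import Data.Nat.ListAction using (sum)

-- The fan graph F_n.  Non-sink vertices 1..n are represented by Fin n:
-- index k : Fin n stands for vertex (toℕ k + 1).  The sink 0 is
-- adjacent to every non-sink vertex.

Adj : {n : ℕ} → Fin n → Fin n → Set
Adj j k = suc (toℕ j) ≡ toℕ k ⊎ suc (toℕ k) ≡ toℕ j

adj? : {n : ℕ} (j k : Fin n) → Dec (Adj j k)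
adj? j k with suc (toℕ j) ℕ.≟ toℕ k | suc (toℕ k) ℕ.≟ toℕ j
... | yes p | _     = yes (Data.Sum.inj₁ p)
... | no _  | yes q = yes (Data.Sum.inj₂ q)
... | no p  | no q  = no λ { (Data.Sum.inj₁ x) → p x ; (Data.Sum.inj₂ y) → q y }

-- degree of a non-sink vertex: 1 (edge to the sink) + number of path neighbours
deg : {n : ℕ} → Fin n → ℕ
deg {n} k = suc (length (filter (λ j → adj? j k) (allFin n)))

Config : ℕ → Set
Config n = Vec ℕ n

Stable : {n : ℕ} → Config n → Set
Stable c = ∀ k → lookup c k < deg k

-- toppling vertex k (grains sent to the sink are lost)
topple : {n : ℕ} → Fin n → Config n → Config n
topple k c = tabulate λ j →
  if ⌊ j ≟ᶠ k ⌋ then lookup c k ∸ deg k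
  else (if ⌊ adj? j k ⌋ then suc (lookup c j) else lookup c j)

data ToppleStep {n : ℕ} (c : Config n) : Config n → Set where
  topples : (k : Fin n) → deg k ≤ lookup c k → ToppleStep c (topple k c)

Stabilises : {n : ℕ} → Config n → Config n → Set
Stabilises c d = Star ToppleStep c d × Stable d

addGrain : {n : ℕ} → Fin n → Config n → Config n
addGrain i c = c [ i ]%= suc

-- one transition of the sandpile Markov chain with positive probability
-- (all μ_i > 0, so the transitions are: add a grain at some i, stabilise)
ChainStep : {n : ℕ} → Config n → Config n → Set
ChainStep c d = Stable c × Σ (Fin _) (λ i → Stabilises (addGrain i c) d)

-- recurrent state of the (finite) Markov chain on stable configurations:
-- every state reachable from c can reach c again
Recurrent : {n : ℕ} → Config n → Set
Recurrent c = Stable c × (∀ d → Star ChainStep c d → Star ChainStep d c)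

level : {n : ℕ} → Config n → ℤ
level {n} c = (+ sum (toList c) - + n) +ℤ + 1

data Letter : Set where
  Lu Lm R : Letter

data ProperlyMarked : List Letter → Set where
  pm-[]  : ProperlyMarked []
  pm-Lu  : ∀ {w} → ProperlyMarked w → ProperlyMarked (Lu ∷ w)
  pm-R   : ∀ {w} → ProperlyMarked w → ProperlyMarked (R ∷ w)
  pm-Lm  : ProperlyMarked (Lm ∷ [])
  pm-LmLu : ∀ {w} → ProperlyMarked (Lu ∷ w) → ProperlyMarked (Lm ∷ Lu ∷ w)
  pm-LmLm : ∀ {w} → ProperlyMarked (Lm ∷ w) → ProperlyMarked (Lm ∷ Lm ∷ w)

isLm : (x : Letter) → Dec (x ≡ Lm)
isLm Lu = no λ ()
isLm Lm = yes _≡_.refl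
isLm R  = no λ ()

markedCount : List Letter → ℕ
markedCount w = length (filter isLm w)

-- orientation of the path edge {i-1,i}:
--   down : i → i-1      up : i-1 → i
data Dir : Set where
  down up : Dir

-- orientation of {i,i+1} given the orientation of {i-1,i} and c_i
-- (values not occurring for recurrent c are sent to an arbitrary default)
nextDir : Dir → ℕ → Dir
nextDir down zero = up
nextDir down (suc _) = down
nextDir up x = if ⌊ x ℕ.≟ 2 ⌋ then down else up

-- phiAux d (c_i ∷ c_{i+1} ∷ … ∷ c_n), where d is the orientation of {i-1,i},
-- produces w_i ⋯ w_{n-1}.  Vertex i+1 < n is marked iff {i,i+1} is
-- oriented i+1 → i and c_{i+1} = 2; vertex n is marked iff {n-1,n} is
-- oriented n → n-1 and c_n = 1.
-- letter for an edge {i,i+1} oriented i+1 → i: given c_{i+1} and whether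
-- i+1 = n (isLast), decide whether i+1 is marked
markLetter : Bool → ℕ → Letter
markLetter true  y = if ⌊ y ℕ.≟ 1 ⌋ then Lm else Lu
markLetter false y = if ⌊ y ℕ.≟ 2 ⌋ then Lm else Lu

isLast : List ℕ → Bool
isLast [] = true
isLast (_ ∷ _) = false

letterFor : Dir → ℕ → List ℕ → Letter
letterFor up   y rest = R
letterFor down y rest = markLetter (isLast rest) y

phiAux : Dir → List ℕ → List Letter
phiAux d [] = []
phiAux d (x ∷ []) = []
phiAux d (x ∷ y ∷ rest) =
  letterFor (nextDir d x) y rest ∷ phiAux (nextDir d x) (y ∷ rest)

-- {0,1} is oriented 1 → 0
ΦF : {n : ℕ} → Config n → List Letter
ΦF c = phiAux down (toList c)

-- A stable configuration of the fan is recurrent iff it has no forbidden interval: two empty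
-- vertices with at most one grain on every vertex between them.  Every stable configuration reaches
-- the maximal stable one by adding grains; that one has no forbidden interval, and adding grains or
-- toppling never creates one.  Conversely, adding grains to the maximal stable configuration reaches
-- c + 𝟏 + 𝟏, and when c has no forbidden interval the burning algorithm topples every vertex of
-- c + 𝟏 exactly once and returns to c.
-- Reading c from left to right, Φ_F orients {i, i+1} towards i+1 exactly while a 0 followed only by
-- 1s is pending, so Φ_F(c) is properly marked precisely for such c, and each letter together with
-- the orientation of the next edge determines c_i, which inverts Φ_F.  At every vertex,
-- (marks at i) + 1 + [i+1 → i] = c_i + [i → i-1], and summing gives level(c) = number of marks.

module Submission where

open import Defs
open import Data.Bool as Bool using (Bool; true; false; if_then_else_)
open import Data.Bool.Properties using (¬-not)
open import Data.Empty using (⊥; ⊥-elim)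
open import Data.Fin using (Fin; toℕ; fromℕ<) renaming (zero to fzero; suc to fsuc)
open import Data.Fin.Properties using (toℕ-fromℕ<; toℕ<n; toℕ-injective; any?; all?; ¬∀⟶∃¬) renaming (_≟_ to _≟ᶠ_)
open import Data.List as List using (List; []; _∷_; length; filter)
open import Data.List.Properties using (foldr-++)
open import Data.Nat
open import Data.Nat.Induction using (<-wellFounded)
open import Data.Nat.ListAction using (sum)
open import Data.Nat.Properties
open import Algebra.Properties.CommutativeSemigroup +-commutativeSemigroup
  using () renaming (interchange to +-interchange; xy∙z≈xz∙y to x+y+z≡x+z+y)
open import Data.Nat.Tactic.RingSolver using (solve-∀)
open import Data.Product using (Σ; ∃; _×_; _,_; proj₁; uncurry)
open import Data.Sum using (_⊎_; inj₁; inj₂; swap; map₁)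
open import Data.Vec using ([]; _∷_; lookup; tabulate; replicate; toList; fromList; zipWith)
open import Data.Vec.Properties using (lookup∘tabulate; lookup-zipWith; length-toList; toList∘fromList)
open import Function using (_∘_; id; flip)
open import Induction.WellFounded using (WellFounded; Acc; acc; module Subrelation)
open import Level using (0ℓ)
open import Relation.Binary.Construct.Closure.ReflexiveTransitive using (Star; ε; _◅_; _◅◅_; gmap)
open import Relation.Binary.Construct.Closure.Transitive using (Plus; [_]; _∼⁺⟨_⟩_)
import Relation.Binary.Construct.On as On
open import Relation.Binary.Definitions using (Tri; tri<; tri≈; tri>)
open import Relation.Binary.PropositionalEquality
open import Relation.Binary.Rewriting using (WeaklyConfluent; sn&wcr⇒cr)
open import Relation.Nullary using (¬_; Dec; yes; no; ⌊_⌋; contradiction)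
open import Relation.Nullary.Decidable using (_×-dec_)
open import Relation.Unary using (Pred; Decidable)

variable
  n : ℕ

-- Position m is vertex m + 1, as toℕ in Defs; positions past the end read as 0.
infixl 9 _‼_
_‼_ : List ℕ → ℕ → ℕ
[]       ‼ _     = 0
(x ∷ xs) ‼ zero  = x
(x ∷ xs) ‼ suc m = xs ‼ m

get : Config n → ℕ → ℕ
get c = toList c ‼_

get-lookup : (c : Config n) (k : Fin n) → get c (toℕ k) ≡ lookup c k
get-lookup (x ∷ c) fzero    = refl
get-lookup (x ∷ c) (fsuc k) = get-lookup c k

get-ext : (c d : Config n) → (∀ {m} → m < n → get c m ≡ get d m) → c ≡ d
get-ext []      []      _  = refl
get-ext (x ∷ c) (y ∷ d) eq = cong₂ _∷_ (eq z<s) (get-ext c d (eq ∘ s<s))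

get-tabulate : ∀ n (f : ℕ → ℕ) {m} → m < n → get (tabulate {n = n} (f ∘ toℕ)) m ≡ f m
get-tabulate (suc n) f {zero}  _         = refl
get-tabulate (suc n) f {suc m} (s≤s m<n) = get-tabulate n (f ∘ suc) m<n

get-replicate : ∀ n x {m} → m < n → get (replicate n x) m ≡ x
get-replicate (suc n) x {zero}  _         = refl
get-replicate (suc n) x {suc m} (s≤s m<n) = get-replicate n x m<n

δ : ℕ → ℕ → ℕ
δ zero    zero    = 1
δ zero    (suc _) = 0
δ (suc _) zero    = 0
δ (suc a) (suc b) = δ a b

δ-refl : ∀ a → δ a a ≡ 1
δ-refl zero    = refl
δ-refl (suc a) = δ-refl a

δ-≢ : ∀ {a b} → a ≢ b → δ a b ≡ 0
δ-≢ {zero}  {zero}  a≢b = contradiction refl a≢b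
δ-≢ {zero}  {suc b} _   = refl
δ-≢ {suc a} {zero}  _   = refl
δ-≢ {suc a} {suc b} a≢b = δ-≢ (a≢b ∘ cong suc)

δ-comm : ∀ a b → δ a b ≡ δ b a
δ-comm zero    zero    = refl
δ-comm zero    (suc b) = refl
δ-comm (suc a) zero    = refl
δ-comm (suc a) (suc b) = δ-comm a b

δ-* : ∀ a b (f : ℕ → ℕ) → δ a b * f a ≡ δ a b * f b
δ-* a b f with a ≟ b
... | yes refl = refl
... | no a≢b   rewrite δ-≢ a≢b = refl

𝟙< : ℕ → ℕ → ℕ
𝟙< a       zero    = 0
𝟙< zero    (suc b) = 1
𝟙< (suc a) (suc b) = 𝟙< a b

𝟙<-≤1 : ∀ a b → 𝟙< a b ≤ 1
𝟙<-≤1 a       zero    = z≤n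
𝟙<-≤1 zero    (suc b) = ≤-refl
𝟙<-≤1 (suc a) (suc b) = 𝟙<-≤1 a b

𝟙<-< : ∀ {a b} → a < b → 𝟙< a b ≡ 1
𝟙<-< {zero}  {suc b} _         = refl
𝟙<-< {suc a} {suc b} (s≤s a<b) = 𝟙<-< a<b

𝟙<-≥ : ∀ {a b} → b ≤ a → 𝟙< a b ≡ 0
𝟙<-≥ {a}     {zero}  _         = refl
𝟙<-≥ {suc a} {suc b} (s≤s b≤a) = 𝟙<-≥ b≤a

sumBelow : ℕ → (ℕ → ℕ) → ℕ
sumBelow zero    f = 0
sumBelow (suc n) f = f 0 + sumBelow n (f ∘ suc)

sumBelow-cong : ∀ n {f g : ℕ → ℕ} → (∀ {m} → m < n → f m ≡ g m) → sumBelow n f ≡ sumBelow n g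
sumBelow-cong zero    eq = refl
sumBelow-cong (suc n) eq = cong₂ _+_ (eq z<s) (sumBelow-cong n (eq ∘ s<s))

sumBelow-+ : ∀ n (f g : ℕ → ℕ) → sumBelow n (λ m → f m + g m) ≡ sumBelow n f + sumBelow n g
sumBelow-+ zero    f g = refl
sumBelow-+ (suc n) f g =
  trans (cong (f 0 + g 0 +_) (sumBelow-+ n (f ∘ suc) (g ∘ suc))) (+-interchange (f 0) (g 0) _ _)

sumBelow-zero : ∀ n → sumBelow n (λ _ → 0) ≡ 0
sumBelow-zero zero    = refl
sumBelow-zero (suc n) = sumBelow-zero n

sumBelow-δ : ∀ n a (g : ℕ → ℕ) → sumBelow n (λ v → δ a v * g v) ≡ 𝟙< a n * g a
sumBelow-δ zero    a       g = refl
sumBelow-δ (suc n) zero    g = trans (cong (1 * g 0 +_) (sumBelow-zero n)) (+-identityʳ _)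
sumBelow-δ (suc n) (suc a) g = sumBelow-δ n a (g ∘ suc)

Neighbours : ℕ → ℕ → Set
Neighbours a b = suc a ≡ b ⊎ suc b ≡ a

adj : ℕ → ℕ → ℕ
adj a b = δ (suc a) b + δ a (suc b)

adj-comm : ∀ a b → adj a b ≡ adj b a
adj-comm a b = trans (+-comm (δ (suc a) b) _) (cong₂ _+_ (δ-comm a (suc b)) (δ-comm (suc a) b))

adj-≡1 : ∀ {a b} → Neighbours a b → adj a b ≡ 1
adj-≡1 {a} (inj₁ refl) = cong₂ _+_ (δ-refl (suc a)) (δ-≢ (<⇒≢ (m<n⇒m<1+n (n<1+n a))))
adj-≡1 {b = b} (inj₂ refl) = cong₂ _+_ (δ-≢ (>⇒≢ (m<n⇒m<1+n (n<1+n b)))) (δ-refl (suc b))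

adj-≡0 : ∀ {a b} → ¬ Neighbours a b → adj a b ≡ 0
adj-≡0 ¬nb = cong₂ _+_ (δ-≢ (¬nb ∘ inj₁)) (δ-≢ (¬nb ∘ inj₂ ∘ sym))

¬Neighbours-self : ∀ a → ¬ Neighbours a a
¬Neighbours-self a (inj₁ eq) = 1+n≢n eq
¬Neighbours-self a (inj₂ eq) = 1+n≢n eq

adj-self : ∀ a → adj a a ≡ 0
adj-self a = adj-≡0 (¬Neighbours-self a)

sumBelow-adj-* : ∀ n {m} (g : ℕ → ℕ) → m < n →
  sumBelow n (λ v → adj m v * g v) ≡ 𝟙< 0 m * g (pred m) + 𝟙< (suc m) n * g (suc m)
sumBelow-adj-* n {m} g m<n = begin
  sumBelow n (λ v → adj m v * g v)
    ≡⟨ sumBelow-cong n (λ {v} _ → *-distribʳ-+ (g v) (δ (suc m) v) _) ⟩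
  sumBelow n (λ v → δ (suc m) v * g v + δ m (suc v) * g v)
    ≡⟨ sumBelow-+ n _ _ ⟩
  sumBelow n (λ v → δ (suc m) v * g v) + sumBelow n (λ v → δ m (suc v) * g v)
    ≡⟨ +-comm (sumBelow n (λ v → δ (suc m) v * g v)) _ ⟩
  sumBelow n (λ v → δ m (suc v) * g v) + sumBelow n (λ v → δ (suc m) v * g v)
    ≡⟨ cong₂ _+_ (left m m<n) (sumBelow-δ n (suc m) g) ⟩
  𝟙< 0 m * g (pred m) + 𝟙< (suc m) n * g (suc m) ∎
  where
  open ≡-Reasoning
  left : ∀ m → m < n → sumBelow n (λ v → δ m (suc v) * g v) ≡ 𝟙< 0 m * g (pred m)
  left zero    _   = sumBelow-zero n
  left (suc m) m<n = trans (sumBelow-δ n m g) (cong (_* g m) (𝟙<-< (<⇒≤ m<n)))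

degree : ℕ → ℕ → ℕ
degree n t = suc (𝟙< 0 t + 𝟙< (suc t) n)

sumBelow-adj : ∀ n {t} → t < n → sumBelow n (adj t) ≡ 𝟙< 0 t + 𝟙< (suc t) n
sumBelow-adj n {t} t<n = begin
  sumBelow n (adj t)                      ≡⟨ sumBelow-cong n (λ {v} _ → sym (*-identityʳ (adj t v))) ⟩
  sumBelow n (λ v → adj t v * 1)          ≡⟨ sumBelow-adj-* n (λ _ → 1) t<n ⟩
  𝟙< 0 t * 1 + 𝟙< (suc t) n * 1           ≡⟨ cong₂ _+_ (*-identityʳ (𝟙< 0 t)) (*-identityʳ (𝟙< (suc t) n)) ⟩
  𝟙< 0 t + 𝟙< (suc t) n                   ∎
  where open ≡-Reasoning

length-filter-tabulate : ∀ n {N} {P : Pred (Fin N) 0ℓ} (P? : Decidable P) (f : Fin n → Fin N) (h : ℕ → ℕ) →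
  (∀ i → P (f i) → h (toℕ i) ≡ 1) → (∀ i → ¬ P (f i) → h (toℕ i) ≡ 0) →
  length (filter P? (List.tabulate f)) ≡ sumBelow n h
length-filter-tabulate zero    P? f h P⇒1 ¬P⇒0 = refl
length-filter-tabulate (suc n) P? f h P⇒1 ¬P⇒0 with P? (f fzero)
... | yes p = cong₂ _+_ (sym (P⇒1 fzero p))
                (length-filter-tabulate n P? (f ∘ fsuc) (h ∘ suc) (P⇒1 ∘ fsuc) (¬P⇒0 ∘ fsuc))
... | no ¬p = cong₂ _+_ (sym (¬P⇒0 fzero ¬p))
                (length-filter-tabulate n P? (f ∘ fsuc) (h ∘ suc) (P⇒1 ∘ fsuc) (¬P⇒0 ∘ fsuc))

deg≡suc-sumBelow-adj : (k : Fin n) → deg k ≡ suc (sumBelow n (adj (toℕ k)))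
deg≡suc-sumBelow-adj {n} k = cong suc
  (length-filter-tabulate n (λ j → adj? j k) (λ j → j) (adj (toℕ k))
    (λ _ nb → adj-≡1 (swap nb)) (λ _ ¬nb → adj-≡0 (¬nb ∘ swap)))

deg≡degree : (k : Fin n) → deg k ≡ degree n (toℕ k)
deg≡degree {n} k = trans (deg≡suc-sumBelow-adj k) (cong suc (sumBelow-adj n (toℕ<n k)))

get-fromℕ< : (c : Config n) → ∀ {m} (m<n : m < n) → get c m ≡ lookup c (fromℕ< m<n)
get-fromℕ< c m<n = trans (cong (get c) (sym (toℕ-fromℕ< m<n))) (get-lookup c (fromℕ< m<n))

StableValues : ℕ → (ℕ → ℕ) → Set
StableValues n f = ∀ {m} → m < n → f m < degree n m

stable⇒stableValues : {c : Config n} → Stable c → StableValues n (get c)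
stable⇒stableValues {n} {c} stable {m} m<n = subst₂ _<_ (sym (get-fromℕ< c m<n))
  (trans (deg≡degree (fromℕ< m<n)) (cong (degree n) (toℕ-fromℕ< m<n))) (stable (fromℕ< m<n))

stableValues⇒stable : {c : Config n} → StableValues n (get c) → Stable c
stableValues⇒stable {c = c} stable k = subst₂ _<_ (get-lookup c k) (sym (deg≡degree k)) (stable (toℕ<n k))

-- Toppling and stabilisation

topple-lookup : (k j : Fin n) (x : Config n) → lookup (topple k x) j ≡
  (if ⌊ j ≟ᶠ k ⌋ then lookup x k ∸ deg k else (if ⌊ adj? j k ⌋ then suc (lookup x j) else lookup x j))
topple-lookup k j x = lookup∘tabulate _ j

-- Toppling written additively, so that no truncated subtraction occurs.
topple-get-toℕ : (k j : Fin n) (x : Config n) → deg k ≤ lookup x k →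
  get (topple k x) (toℕ j) + δ (toℕ k) (toℕ j) * deg k ≡ get x (toℕ j) + adj (toℕ k) (toℕ j)
topple-get-toℕ k j x unstable
  rewrite get-lookup (topple k x) j | get-lookup x j | topple-lookup k j x
  with j ≟ᶠ k | adj? j k
... | yes refl | _ = begin
  lookup x k ∸ deg k + δ (toℕ k) (toℕ k) * deg k ≡⟨ cong (λ d → lookup x k ∸ deg k + d * deg k) (δ-refl (toℕ k)) ⟩
  lookup x k ∸ deg k + 1 * deg k                 ≡⟨ cong (lookup x k ∸ deg k +_) (*-identityˡ (deg k)) ⟩
  lookup x k ∸ deg k + deg k                     ≡⟨ m∸n+n≡m unstable ⟩
  lookup x k                                     ≡⟨ sym (+-identityʳ _) ⟩
  lookup x k + 0                                 ≡⟨ cong (lookup x k +_) (sym (adj-self (toℕ k))) ⟩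
  lookup x k + adj (toℕ k) (toℕ k)               ∎
  where open ≡-Reasoning
... | no j≢k | yes nb
  rewrite δ-≢ (j≢k ∘ sym ∘ toℕ-injective) | adj-≡1 (swap nb) = trans (+-identityʳ _) (+-comm 1 _)
... | no j≢k | no ¬nb
  rewrite δ-≢ (j≢k ∘ sym ∘ toℕ-injective) | adj-≡0 (¬nb ∘ swap) = refl

topple-get : (k : Fin n) (x : Config n) → deg k ≤ lookup x k → ∀ {m} → m < n →
  get (topple k x) m + δ (toℕ k) m * deg k ≡ get x m + adj (toℕ k) m
topple-get k x unstable m<n =
  subst (λ m → get (topple k x) m + δ (toℕ k) m * deg k ≡ get x m + adj (toℕ k) m)
    (toℕ-fromℕ< m<n) (topple-get-toℕ k (fromℕ< m<n) x unstable)

topple-≥ : (k : Fin n) (x : Config n) → deg k ≤ lookup x k → ∀ {m} → m < n → toℕ k ≢ m →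
  get x m ≤ get (topple k x) m
topple-≥ k x unstable {m} m<n k≢m = begin
  get x m                                  ≤⟨ m≤m+n (get x m) _ ⟩
  get x m + adj (toℕ k) m                  ≡⟨ topple-get k x unstable m<n ⟨
  get (topple k x) m + δ (toℕ k) m * deg k ≡⟨ cong (λ d → get (topple k x) m + d * deg k) (δ-≢ k≢m) ⟩
  get (topple k x) m + 0                   ≡⟨ +-identityʳ _ ⟩
  get (topple k x) m                       ∎
  where open ≤-Reasoning

topple-neighbour : (k : Fin n) (x : Config n) → deg k ≤ lookup x k → ∀ {m} → m < n → Neighbours m (toℕ k) →
  get (topple k x) m ≡ suc (get x m)
topple-neighbour k x unstable {m} m<n nb = begin
  get (topple k x) m                       ≡⟨ +-identityʳ _ ⟨
  get (topple k x) m + 0 * deg k           ≡⟨ cong (λ d → get (topple k x) m + d * deg k) (δ-≢ k≢m) ⟨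
  get (topple k x) m + δ (toℕ k) m * deg k ≡⟨ topple-get k x unstable m<n ⟩
  get x m + adj (toℕ k) m                  ≡⟨ cong (get x m +_) (adj-≡1 (swap nb)) ⟩
  get x m + 1                              ≡⟨ +-comm (get x m) 1 ⟩
  suc (get x m)                            ∎
  where
  open ≡-Reasoning
  k≢m : toℕ k ≢ m
  k≢m refl = ¬Neighbours-self m nb

unstable-after-topple : (k l : Fin n) (x : Config n) → k ≢ l → deg k ≤ lookup x k → deg l ≤ lookup x l →
  deg k ≤ lookup (topple l x) k
unstable-after-topple k l x k≢l unstable-k unstable-l = begin
  deg k                         ≤⟨ unstable-k ⟩
  lookup x k                    ≡⟨ get-lookup x k ⟨
  get x (toℕ k)                 ≤⟨ topple-≥ l x unstable-l (toℕ<n k) (k≢l ∘ sym ∘ toℕ-injective) ⟩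
  get (topple l x) (toℕ k)      ≡⟨ get-lookup (topple l x) k ⟩
  lookup (topple l x) k         ∎
  where open ≤-Reasoning

total : Config n → ℕ
total {n} c = sumBelow n (get c)

total-topple : (k : Fin n) (x : Config n) → deg k ≤ lookup x k → suc (total (topple k x)) ≡ total x
total-topple {n} k x unstable = +-cancelʳ-≡ _ _ _ (begin
  suc (total (topple k x)) + A                                    ≡⟨ +-suc _ A ⟨
  total (topple k x) + suc A                                      ≡⟨ cong (total (topple k x) +_) deg-eq ⟩
  total (topple k x) + sumBelow n (λ m → δ (toℕ k) m * deg k)     ≡⟨ sumBelow-+ n _ _ ⟨
  sumBelow n (λ m → get (topple k x) m + δ (toℕ k) m * deg k)     ≡⟨ sumBelow-cong n (topple-get k x unstable) ⟩
  sumBelow n (λ m → get x m + adj (toℕ k) m)                      ≡⟨ sumBelow-+ n _ _ ⟩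
  total x + A                                                     ∎)
  where
  open ≡-Reasoning
  A = sumBelow n (adj (toℕ k))
  deg-eq : suc A ≡ sumBelow n (λ m → δ (toℕ k) m * deg k)
  deg-eq = begin
    suc A                    ≡⟨ deg≡suc-sumBelow-adj k ⟨
    deg k                    ≡⟨ +-identityʳ (deg k) ⟨
    1 * deg k                ≡⟨ cong (_* deg k) (𝟙<-< (toℕ<n k)) ⟨
    𝟙< (toℕ k) n * deg k     ≡⟨ sumBelow-δ n (toℕ k) (λ _ → deg k) ⟨
    sumBelow n (λ m → δ (toℕ k) m * deg k) ∎

topple-comm : (k l : Fin n) (x : Config n) → k ≢ l → deg k ≤ lookup x k → deg l ≤ lookup x l →
  topple k (topple l x) ≡ topple l (topple k x)
topple-comm {n} k l x k≢l unstable-k unstable-l = get-ext _ _ λ {m} m<n → +-cancelʳ-≡ _ _ _ (begin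
  get (topple k (topple l x)) m + (Δ k m + Δ l m)  ≡⟨ balance k l k≢l unstable-k unstable-l m<n ⟩
  get x m + adj (toℕ l) m + adj (toℕ k) m          ≡⟨ x+y+z≡x+z+y (get x m) _ _ ⟩
  get x m + adj (toℕ k) m + adj (toℕ l) m          ≡⟨ balance l k (k≢l ∘ sym) unstable-l unstable-k m<n ⟨
  get (topple l (topple k x)) m + (Δ l m + Δ k m)  ≡⟨ cong (get (topple l (topple k x)) m +_)
                                                             (+-comm (Δ l m) (Δ k m)) ⟩
  get (topple l (topple k x)) m + (Δ k m + Δ l m)  ∎)
  where
  open ≡-Reasoning
  Δ : Fin n → ℕ → ℕ
  Δ k m = δ (toℕ k) m * deg k
  balance : (k l : Fin n) → k ≢ l → deg k ≤ lookup x k → deg l ≤ lookup x l → ∀ {m} → m < n →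
    get (topple k (topple l x)) m + (Δ k m + Δ l m) ≡ get x m + adj (toℕ l) m + adj (toℕ k) m
  balance k l k≢l unstable-k unstable-l {m} m<n = begin
    get (topple k (topple l x)) m + (Δ k m + Δ l m)   ≡⟨ +-assoc _ (Δ k m) (Δ l m) ⟨
    get (topple k (topple l x)) m + Δ k m + Δ l m     ≡⟨ cong (_+ Δ l m) (topple-get k (topple l x) unstable-k′ m<n) ⟩
    get (topple l x) m + adj (toℕ k) m + Δ l m        ≡⟨ x+y+z≡x+z+y (get (topple l x) m) _ _ ⟩
    get (topple l x) m + Δ l m + adj (toℕ k) m        ≡⟨ cong (_+ adj (toℕ k) m) (topple-get l x unstable-l m<n) ⟩
    get x m + adj (toℕ l) m + adj (toℕ k) m           ∎
    where
    open ≡-Reasoning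
    unstable-k′ = unstable-after-topple k l x k≢l unstable-k unstable-l

toppleStep-decreasing : {x y : Config n} → ToppleStep x y → total y < total x
toppleStep-decreasing {x = x} (topples k unstable) = ≤-reflexive (total-topple k x unstable)

topplings-decreasing : {x y : Config n} → Plus ToppleStep x y → total y < total x
topplings-decreasing [ step ]          = toppleStep-decreasing step
topplings-decreasing (_ ∼⁺⟨ p ⟩ q) = <-trans (topplings-decreasing q) (topplings-decreasing p)

toppling-terminates : WellFounded (flip (Plus (ToppleStep {n})))
toppling-terminates = Subrelation.wellFounded topplings-decreasing (On.wellFounded total <-wellFounded)

toppling-weaklyConfluent : WeaklyConfluent (ToppleStep {n})
toppling-weaklyConfluent {A = x} (topples k unstable-k) (topples l unstable-l) with k ≟ᶠ l
... | yes refl = _ , ε , ε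
... | no k≢l   = topple l (topple k x)
               , topples l (unstable-after-topple l k x (k≢l ∘ sym) unstable-l unstable-k) ◅ ε
               , subst (Star ToppleStep (topple l x)) (topple-comm k l x k≢l unstable-k unstable-l)
                   (topples k (unstable-after-topple k l x k≢l unstable-k unstable-l) ◅ ε)

stable⇒no-topplings : {x y : Config n} → Stable x → Star ToppleStep x y → x ≡ y
stable⇒no-topplings _      ε                         = refl
stable⇒no-topplings stable (topples k unstable ◅ _) = contradiction (stable k) (≤⇒≯ unstable)

stabilisation-unique : {x y z : Config n} → Stabilises x y → Stabilises x z → y ≡ z
stabilisation-unique (x→y , y-stable) (x→z , z-stable)
  with sn&wcr⇒cr toppling-terminates toppling-weaklyConfluent x→y x→z
... | w , y→w , z→w = trans (stable⇒no-topplings y-stable y→w) (sym (stable⇒no-topplings z-stable z→w))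

stable-or-unstable : (x : Config n) → Stable x ⊎ ∃ λ k → deg k ≤ lookup x k
stable-or-unstable {n} x with all? (λ k → lookup x k <? deg k)
... | yes stable = inj₁ stable
... | no ¬stable with ¬∀⟶∃¬ n _ (λ k → lookup x k <? deg k) ¬stable
...   | k , ¬x<deg = inj₂ (k , ≮⇒≥ ¬x<deg)

stabilise : (x : Config n) → ∃ (Stabilises x)
stabilise x = go x (toppling-terminates x)
  where
  go : ∀ x → Acc (flip (Plus ToppleStep)) x → ∃ (Stabilises x)
  go x (acc rs) with stable-or-unstable x
  ... | inj₁ stable = x , ε , stable
  ... | inj₂ (k , unstable) with go (topple k x) (rs [ topples k unstable ])
  ...   | y , topplings , y-stable = y , topples k unstable ◅ topplings , y-stable

infixl 6 _⊕_
_⊕_ : Config n → Config n → Config n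
_⊕_ = zipWith _+_

get-⊕ : (c d : Config n) → ∀ {m} → m < n → get (c ⊕ d) m ≡ get c m + get d m
get-⊕ (x ∷ c) (y ∷ d) {zero}  _         = refl
get-⊕ (x ∷ c) (y ∷ d) {suc m} (s≤s m<n) = get-⊕ c d m<n

unstable-⊕ : (k : Fin n) (x a : Config n) → deg k ≤ lookup x k → deg k ≤ lookup (x ⊕ a) k
unstable-⊕ k x a unstable = ≤-trans unstable (≤-trans (m≤m+n _ _) (≤-reflexive (sym (lookup-zipWith _+_ k x a))))

topple-⊕ : (k : Fin n) (x a : Config n) → deg k ≤ lookup x k → topple k (x ⊕ a) ≡ topple k x ⊕ a
topple-⊕ {n} k x a unstable = get-ext _ _ λ {m} m<n → +-cancelʳ-≡ _ _ _ (begin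
  get (topple k (x ⊕ a)) m + Δ m      ≡⟨ topple-get k (x ⊕ a) (unstable-⊕ k x a unstable) m<n ⟩
  get (x ⊕ a) m + adj (toℕ k) m       ≡⟨ cong (_+ adj (toℕ k) m) (get-⊕ x a m<n) ⟩
  get x m + get a m + adj (toℕ k) m   ≡⟨ x+y+z≡x+z+y (get x m) _ _ ⟩
  get x m + adj (toℕ k) m + get a m   ≡⟨ cong (_+ get a m) (topple-get k x unstable m<n) ⟨
  get (topple k x) m + Δ m + get a m  ≡⟨ x+y+z≡x+z+y (get (topple k x) m) _ _ ⟩
  get (topple k x) m + get a m + Δ m  ≡⟨ cong (_+ Δ m) (get-⊕ (topple k x) a m<n) ⟨
  get (topple k x ⊕ a) m + Δ m        ∎)
  where
  open ≡-Reasoning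
  Δ : ℕ → ℕ
  Δ m = δ (toℕ k) m * deg k

toppleStep-⊕ : {x y : Config n} (a : Config n) → ToppleStep x y → ToppleStep (x ⊕ a) (y ⊕ a)
toppleStep-⊕ {x = x} a (topples k unstable) =
  subst (ToppleStep (x ⊕ a)) (topple-⊕ k x a unstable) (topples k (unstable-⊕ k x a unstable))

topplings-⊕ : {x y : Config n} (a : Config n) → Star ToppleStep x y → Star ToppleStep (x ⊕ a) (y ⊕ a)
topplings-⊕ a = gmap (_⊕ a) (toppleStep-⊕ a)

-- Reaching configurations in the sandpile chain

⊕-identityʳ : (x : Config n) → x ⊕ replicate n 0 ≡ x
⊕-identityʳ []       = refl
⊕-identityʳ (x ∷ xs) = cong₂ _∷_ (+-identityʳ x) (⊕-identityʳ xs)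

⊕-addGrain : (i : Fin n) (x v : Config n) → x ⊕ addGrain i v ≡ addGrain i x ⊕ v
⊕-addGrain fzero    (x ∷ xs) (v ∷ vs) = cong (_∷ zipWith _+_ xs vs) (+-suc x v)
⊕-addGrain (fsuc i) (x ∷ xs) (v ∷ vs) = cong (x + v ∷_) (⊕-addGrain i xs vs)

addGrains : List (Fin n) → Config n → Config n
addGrains is x = List.foldr addGrain x is

grains : Config n → List (Fin n)
grains []       = []
grains (a ∷ as) = List.replicate a fzero List.++ List.map fsuc (grains as)

addGrains-grains : (a : Config n) → addGrains (grains a) (replicate n 0) ≡ a
addGrains-grains []       = refl
addGrains-grains {suc n} (a ∷ as) = begin
  addGrains (List.replicate a fzero List.++ List.map fsuc (grains as)) (replicate (suc n) 0)
    ≡⟨ foldr-++ addGrain (replicate (suc n) 0) (List.replicate a fzero) _ ⟩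
  addGrains (List.replicate a fzero) (addGrains (List.map fsuc (grains as)) (replicate (suc n) 0))
    ≡⟨ cong (addGrains (List.replicate a fzero)) (addGrains-map-fsuc (grains as) (replicate n 0)) ⟩
  addGrains (List.replicate a fzero) (0 ∷ addGrains (grains as) (replicate n 0))
    ≡⟨ cong (λ v → addGrains (List.replicate a fzero) (0 ∷ v)) (addGrains-grains as) ⟩
  addGrains (List.replicate a fzero) (0 ∷ as)
    ≡⟨ addGrains-replicate-fzero a ⟩
  a ∷ as ∎
  where
  open ≡-Reasoning
  addGrains-map-fsuc : ∀ is (v : Config n) → addGrains (List.map fsuc is) (0 ∷ v) ≡ 0 ∷ addGrains is v
  addGrains-map-fsuc []       v = refl
  addGrains-map-fsuc (i ∷ is) v = cong (addGrain (fsuc i)) (addGrains-map-fsuc is v)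
  addGrains-replicate-fzero : ∀ a → addGrains (List.replicate a fzero) (0 ∷ as) ≡ a ∷ as
  addGrains-replicate-fzero zero    = refl
  addGrains-replicate-fzero (suc a) = cong (addGrain fzero) (addGrains-replicate-fzero a)

chain-addGrains : (is : List (Fin n)) {x y : Config n} → Stable x →
  Stabilises (x ⊕ addGrains is (replicate n 0)) y → Star ChainStep x y
chain-addGrains []       {x} x-stable (x→y , y-stable)
  with stable⇒no-topplings x-stable (subst (λ v → Star ToppleStep v _) (⊕-identityʳ x) x→y)
... | refl = ε
chain-addGrains {n} (i ∷ is) {x} {y} x-stable (x→y , y-stable)
  with z , x+i→z , z-stable ← stabilise (addGrain i x) =
  (x-stable , i , x+i→z , z-stable) ◅ chain-addGrains is z-stable z+v-stabilises
  where
  v = addGrains is (replicate n 0)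
  z+v-stabilises : Stabilises (z ⊕ v) y
  z+v-stabilises with y′ , z+v→y′ , y′-stable ← stabilise (z ⊕ v) =
    subst (Stabilises (z ⊕ v)) (sym y≡y′) (z+v→y′ , y′-stable)
    where
    y≡y′ : y ≡ y′
    y≡y′ = stabilisation-unique (subst (λ w → Star ToppleStep w y) (⊕-addGrain i x v) x→y , y-stable)
                                (topplings-⊕ v x+i→z ◅◅ z+v→y′ , y′-stable)

chain-⊕ : (a : Config n) {x y : Config n} → Stable x → Stabilises (x ⊕ a) y → Star ChainStep x y
chain-⊕ {n} a {x} x-stable x+a→y =
  chain-addGrains (grains a) x-stable (subst (λ a → Stabilises (x ⊕ a) _) (sym (addGrains-grains a)) x+a→y)

maxStable : Config n
maxStable {n} = tabulate ((λ m → degree n m ∸ 1) ∘ toℕ)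

maxStable-stable : Stable (maxStable {n})
maxStable-stable {n} = stableValues⇒stable {c = maxStable} λ {m} m<n →
  subst (_< degree n m) (sym (get-tabulate n (λ m → degree n m ∸ 1) m<n)) ≤-refl

chain-to-maxStable : {c : Config n} → Stable c → Star ChainStep c maxStable
chain-to-maxStable {n} {c} c-stable =
  chain-⊕ missing c-stable (subst (λ v → Stabilises v maxStable) (sym c+missing≡max) (ε , maxStable-stable))
  where
  missing : Config n
  missing = tabulate ((λ m → (degree n m ∸ 1) ∸ get c m) ∘ toℕ)
  c+missing≡max : c ⊕ missing ≡ maxStable
  c+missing≡max = get-ext _ _ λ {m} m<n → begin
    get (c ⊕ missing) m                      ≡⟨ get-⊕ c missing m<n ⟩
    get c m + get missing m                  ≡⟨ cong (get c m +_) (get-tabulate n (λ m → _ ∸ get c m) m<n) ⟩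
    get c m + ((degree n m ∸ 1) ∸ get c m)   ≡⟨ m+[n∸m]≡n (s≤s⁻¹ (stable⇒stableValues {c = c} c-stable m<n)) ⟩
    degree n m ∸ 1                           ≡⟨ get-tabulate n (λ m → degree n m ∸ 1) m<n ⟨
    get (maxStable {n}) m                    ∎
    where open ≡-Reasoning

-- Forbidden intervals

-- On the fan these intervals are the minimal forbidden subconfigurations: every vertex of [a, b]
-- holds fewer grains than it has neighbours in [a, b].
record ForbiddenInterval (f : ℕ → ℕ) (a b : ℕ) : Set where
  constructor forbidden
  field
    a<b     : a < b
    left≡0  : f a ≡ 0
    right≡0 : f b ≡ 0
    inner≤1 : ∀ {v} → a < v → v < b → f v ≤ 1

NoForbiddenInterval : ℕ → (ℕ → ℕ) → Set
NoForbiddenInterval n f = ∀ {a b} → b < n → ¬ ForbiddenInterval f a b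

forbidden-sub : ∀ {f g : ℕ → ℕ} {a b a′ b′} → a ≤ a′ → b′ ≤ b → a′ < b′ → f a′ ≡ 0 → f b′ ≡ 0 →
  (∀ {v} → a′ < v → v < b′ → f v ≤ g v) → ForbiddenInterval g a b → ForbiddenInterval f a′ b′
forbidden-sub a≤a′ b′≤b a′<b′ left right f≤g fi = forbidden a′<b′ left right λ a′<v v<b′ →
  ≤-trans (f≤g a′<v v<b′) (inner≤1 (≤-<-trans a≤a′ a′<v) (<-≤-trans v<b′ b′≤b))
  where open ForbiddenInterval fi

zero-below : ∀ {x y} → x ≤ y → y ≡ 0 → x ≡ 0
zero-below {x} x≤y y≡0 = n≤0⇒n≡0 (subst (x ≤_) y≡0 x≤y)

noForbidden-mono : ∀ {n} {f g : ℕ → ℕ} → (∀ {v} → v < n → f v ≤ g v) →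
  NoForbiddenInterval n f → NoForbiddenInterval n g
noForbidden-mono f≤g no-fi b<n fi = no-fi b<n (forbidden-sub ≤-refl ≤-refl a<b
  (zero-below (f≤g (<-trans a<b b<n)) left≡0) (zero-below (f≤g b<n) right≡0) (λ _ v<b → f≤g (<-trans v<b b<n)) fi)
  where open ForbiddenInterval fi

module _ (k : Fin n) (x : Config n) (unstable : deg k ≤ lookup x k) where
  private
    t = toℕ k
    y = topple k x

    x≤y : ∀ {v} → v < n → t ≢ v → get x v ≤ get y v
    x≤y = topple-≥ k x unstable

    x-zero : ∀ {v} → v < n → t ≢ v → get y v ≡ 0 → get x v ≡ 0
    x-zero v<n t≢v = zero-below (x≤y v<n t≢v)

    neighbour-empty : ∀ {w} → w < n → Neighbours w t → get y w ≤ 1 → get x w ≡ 0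
    neighbour-empty w<n nb y≤1 = n≤0⇒n≡0 (s≤s⁻¹ (subst (_≤ 1) (topple-neighbour k x unstable w<n nb) y≤1))

    neighbour-nonempty : ∀ {w} → w < n → Neighbours w t → get y w ≢ 0
    neighbour-nonempty w<n nb y≡0 = 1+n≢0 (trans (sym (topple-neighbour k x unstable w<n nb)) y≡0)

    predecessor : ∀ {a t} → a < t → ∃ λ t′ → suc t′ ≡ t
    predecessor {t = suc t′} _ = t′ , refl

    shrink : ∀ {a b a′ b′} → b < n → ForbiddenInterval (get y) a b → a ≤ a′ → b′ ≤ b → a′ < b′ →
      get x a′ ≡ 0 → get x b′ ≡ 0 → (∀ {v} → a′ < v → v < b′ → t ≢ v) → ForbiddenInterval (get x) a′ b′
    shrink b<n fi a≤a′ b′≤b a′<b′ x[a′]≡0 x[b′]≡0 avoid = forbidden-sub a≤a′ b′≤b a′<b′ x[a′]≡0 x[b′]≡0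
      (λ a′<v v<b′ → x≤y (<-trans (<-≤-trans v<b′ b′≤b) b<n) (avoid a′<v v<b′)) fi

  forbidden-topple-away : ∀ {a b} → b < n → ForbiddenInterval (get y) a b →
    (∀ {v} → a ≤ v → v ≤ b → t ≢ v) → ForbiddenInterval (get x) a b
  forbidden-topple-away b<n fi avoid = shrink b<n fi ≤-refl ≤-refl a<b
    (x-zero (<-trans a<b b<n) (avoid ≤-refl (<⇒≤ a<b)) left≡0) (x-zero b<n (avoid (<⇒≤ a<b) ≤-refl) right≡0)
    (λ a<v v<b → avoid (<⇒≤ a<v) (<⇒≤ v<b))
    where open ForbiddenInterval fi

  -- The right neighbour of t received a grain, so it is not the end b and was empty before.
  forbidden-topple-start : ∀ {a b} → b < n → ForbiddenInterval (get y) a b → t ≡ a →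
    ForbiddenInterval (get x) (suc a) b
  forbidden-topple-start {a} {b} b<n fi t≡a = shrink b<n fi (n≤1+n a) ≤-refl a+1<b
    (neighbour-empty a+1<n nb (inner≤1 ≤-refl a+1<b)) (x-zero b<n (λ t≡b → <⇒≢ a<b (trans (sym t≡a) t≡b)) right≡0)
    (λ a+1<v _ t≡v → <⇒≢ (<-trans (n<1+n a) a+1<v) (trans (sym t≡a) t≡v))
    where
    open ForbiddenInterval fi
    nb : Neighbours (suc a) t
    nb = inj₂ (cong suc t≡a)
    a+1<n : suc a < n
    a+1<n = ≤-<-trans a<b b<n
    a+1<b : suc a < b
    a+1<b = ≤∧≢⇒< a<b λ a+1≡b → neighbour-nonempty a+1<n nb (subst (λ v → get y v ≡ 0) (sym a+1≡b) right≡0)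

  forbidden-topple-inside : ∀ {a b t′} → b < n → ForbiddenInterval (get y) a b → suc t′ ≡ t → a < t → t′ < b →
    ForbiddenInterval (get x) a t′
  forbidden-topple-inside {a} {b} {t′} b<n fi t′+1≡t a<t t′<b = shrink b<n fi ≤-refl (<⇒≤ t′<b) a<t′
    (x-zero (<-trans a<b b<n) (>⇒≢ a<t) left≡0) (neighbour-empty t′<n nb (inner≤1 a<t′ t′<b))
    (λ _ v<t′ t≡v → >⇒≢ (<-trans v<t′ t′<t) t≡v)
    where
    open ForbiddenInterval fi
    nb : Neighbours t′ t
    nb = inj₁ t′+1≡t
    t′<t : t′ < t
    t′<t = subst (t′ <_) t′+1≡t ≤-refl
    t′<n : t′ < n
    t′<n = <-trans t′<b b<n
    a<t′ : a < t′
    a<t′ = ≤∧≢⇒< (s≤s⁻¹ (subst (a <_) (sym t′+1≡t) a<t))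
      λ a≡t′ → neighbour-nonempty t′<n nb (subst (λ v → get y v ≡ 0) a≡t′ left≡0)

  noForbidden-topple : NoForbiddenInterval n (get x) → NoForbiddenInterval n (get y)
  noForbidden-topple no-fi {a} {b} b<n fi = refute (<-cmp t a) (t ≤? b)
    where
    refute : Tri (t < a) (t ≡ a) (t > a) → Dec (t ≤ b) → ⊥
    refute (tri< t<a _ _) _        = no-fi b<n (forbidden-topple-away b<n fi λ a≤v _ → <⇒≢ (<-≤-trans t<a a≤v))
    refute _              (no t≰b) =
      no-fi b<n (forbidden-topple-away b<n fi λ _ v≤b t≡v → t≰b (subst (_≤ b) (sym t≡v) v≤b))
    refute (tri≈ _ t≡a _) (yes _)  = no-fi b<n (forbidden-topple-start b<n fi t≡a)
    refute (tri> _ _ a<t) (yes t≤b) with t′ , t′+1≡t ← predecessor a<t =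
      no-fi (<-trans t′<b b<n) (forbidden-topple-inside b<n fi t′+1≡t a<t t′<b)
      where
      t′<b = subst (_≤ b) (sym t′+1≡t) t≤b

get-addGrain-≥ : (i : Fin n) (x : Config n) (v : ℕ) → get x v ≤ get (addGrain i x) v
get-addGrain-≥ fzero    (x ∷ xs) zero    = n≤1+n x
get-addGrain-≥ fzero    (x ∷ xs) (suc v) = ≤-refl
get-addGrain-≥ (fsuc i) (x ∷ xs) zero    = ≤-refl
get-addGrain-≥ (fsuc i) (x ∷ xs) (suc v) = get-addGrain-≥ i xs v

noForbidden-topplings : {x y : Config n} → Star ToppleStep x y →
  NoForbiddenInterval n (get x) → NoForbiddenInterval n (get y)
noForbidden-topplings ε                              = id
noForbidden-topplings {x = x} (topples k unstable ◅ topplings) =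
  noForbidden-topplings topplings ∘ noForbidden-topple k x unstable

noForbidden-chain : {x y : Config n} → Star ChainStep x y →
  NoForbiddenInterval n (get x) → NoForbiddenInterval n (get y)
noForbidden-chain ε                                          = id
noForbidden-chain {x = x} ((_ , i , topplings , _) ◅ steps) =
  noForbidden-chain steps ∘ noForbidden-topplings topplings ∘ noForbidden-mono (λ {v} _ → get-addGrain-≥ i x v)

noForbidden-maxStable : NoForbiddenInterval n (get (maxStable {n}))
noForbidden-maxStable {n} {a} b<n fi = 1+n≢0 (begin
  suc (𝟙< 0 a)                 ≡⟨ +-comm 1 (𝟙< 0 a) ⟩
  𝟙< 0 a + 1                   ≡⟨ cong (𝟙< 0 a +_) (𝟙<-< (≤-<-trans a<b b<n)) ⟨
  𝟙< 0 a + 𝟙< (suc a) n        ≡⟨ get-tabulate n (λ m → degree n m ∸ 1) (<-trans a<b b<n) ⟨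
  get (maxStable {n}) a        ≡⟨ left≡0 ⟩
  0                            ∎)
  where
  open ForbiddenInterval fi
  open ≡-Reasoning

-- Burning

⟦_⟧ : Bool → ℕ
⟦ true  ⟧ = 1
⟦ false ⟧ = 0

*⟦⟧-absorb : ∀ x {b} → x ≡ 0 ⊎ b ≡ true → x * ⟦ b ⟧ ≡ x
*⟦⟧-absorb x (inj₁ refl) = refl
*⟦⟧-absorb x (inj₂ refl) = *-identityʳ x

left-edge-term : ∀ (S : ℕ → Bool) {v} → v ≡ 0 ⊎ S (pred v) ≡ true → 𝟙< 0 v * ⟦ S (pred v) ⟧ ≡ 𝟙< 0 v
left-edge-term S {v} left-edge = *⟦⟧-absorb (𝟙< 0 v) (map₁ (cong (𝟙< 0)) left-edge)

right-edge-term : ∀ (S : ℕ → Bool) {n v} → suc v ≡ n ⊎ S (suc v) ≡ true →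
  𝟙< (suc v) n * ⟦ S (suc v) ⟧ ≡ 𝟙< (suc v) n
right-edge-term S {n} {v} right-edge =
  *⟦⟧-absorb (𝟙< (suc v) n) (map₁ (λ v+1≡n → 𝟙<-≥ (≤-reflexive (sym v+1≡n))) right-edge)

insert : (ℕ → Bool) → ℕ → ℕ → Bool
insert S v m = if ⌊ m ≟ v ⌋ then true else S m

⟦insert⟧ : ∀ S {v} m → S v ≡ false → ⟦ insert S v m ⟧ ≡ ⟦ S m ⟧ + δ v m
⟦insert⟧ S {v} m Sv≡false with m ≟ v
... | yes refl rewrite Sv≡false | δ-refl m = refl
... | no  m≢v  rewrite δ-≢ (m≢v ∘ sym)     = sym (+-identityʳ _)

run-start : (S : ℕ → Bool) → ∀ {u} → S u ≡ false →
  ∃ λ a → a ≤ u × (∀ {v} → a ≤ v → v ≤ u → S v ≡ false) × (a ≡ 0 ⊎ S (pred a) ≡ true)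
run-start S {zero} S0≡false =
  0 , z≤n , (λ {v} _ v≤0 → subst (λ v → S v ≡ false) (sym (n≤0⇒n≡0 v≤0)) S0≡false) , inj₁ refl
run-start S {suc u} Su+1≡false with S u in Su≡b
... | true  =
  suc u , ≤-refl , (λ u<v v≤u+1 → subst (λ v → S v ≡ false) (≤-antisym u<v v≤u+1) Su+1≡false) , inj₂ Su≡b
... | false with a , a≤u , run , edge ← run-start S Su≡b =
  a , m≤n⇒m≤1+n a≤u , extend , edge
  where
  extend : ∀ {v} → a ≤ v → v ≤ suc u → S v ≡ false
  extend a≤v v≤u+1 with m≤n⇒m<n∨m≡n v≤u+1
  ... | inj₁ v<u+1 = run a≤v (s≤s⁻¹ v<u+1)
  ... | inj₂ refl  = Su+1≡false

run-end : (S : ℕ → Bool) → ∀ {n} d {u} → suc (u + d) ≡ n → S u ≡ false →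
  ∃ λ b → u ≤ b × b < n × (∀ {v} → u ≤ v → v ≤ b → S v ≡ false) × (suc b ≡ n ⊎ S (suc b) ≡ true)
run-end S zero {u} u+1≡n Su≡false =
  u , ≤-refl , u<n , (λ u≤v v≤u → subst (λ v → S v ≡ false) (≤-antisym u≤v v≤u) Su≡false) , inj₁ u+1≡n′
  where
  u+1≡n′ = trans (cong suc (sym (+-identityʳ u))) u+1≡n
  u<n = ≤-reflexive u+1≡n′
run-end S (suc d) {u} u+d+2≡n Su≡false with S (suc u) in Su+1≡b
... | true  =
  u , ≤-refl , u<n , (λ u≤v v≤u → subst (λ v → S v ≡ false) (≤-antisym u≤v v≤u) Su≡false) , inj₂ Su+1≡b
  where
  u<n = ≤-trans (s≤s (m≤m+n u (suc d))) (≤-reflexive u+d+2≡n)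
... | false with b , u<b , b<n , run , edge ← run-end S d (trans (cong suc (sym (+-suc u d))) u+d+2≡n) Su+1≡b =
  b , <⇒≤ u<b , b<n , extend , edge
  where
  extend : ∀ {v} → u ≤ v → v ≤ b → S v ≡ false
  extend u≤v v≤b with m≤n⇒m<n∨m≡n u≤v
  ... | inj₁ u<v  = run u<v v≤b
  ... | inj₂ refl = Su≡false

x+[p+q]<p+r⇒x<r : ∀ x p q r → x + (p + q) < p + r → x < r
x+[p+q]<p+r⇒x<r x p q r lt = +-cancelˡ-< p x r (begin-strict
  p + x        ≡⟨ +-comm p x ⟩
  x + p        ≤⟨ +-monoʳ-≤ x (m≤m+n p q) ⟩
  x + (p + q)  <⟨ lt ⟩
  p + r        ∎)
  where open ≤-Reasoning

-- S is the set of vertices that have already toppled, each exactly once, starting from c + 𝟏.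
module Burning {n} (c : Config n) where

  burntNeighbours : (ℕ → Bool) → ℕ → ℕ
  burntNeighbours S m = sumBelow n (λ v → adj m v * ⟦ S v ⟧)

  received : (ℕ → Bool) → ℕ → ℕ
  received S m = suc (get c m + burntNeighbours S m)

  state : (ℕ → Bool) → Config n
  state S = tabulate ((λ m → received S m ∸ ⟦ S m ⟧ * degree n m) ∘ toℕ)

  LegallyToppled : (ℕ → Bool) → Set
  LegallyToppled S = ∀ {m} → m < n → S m ≡ true → degree n m ≤ received S m

  Ready : (ℕ → Bool) → ℕ → Set
  Ready S v = S v ≡ false × degree n v ≤ received S v

  ready? : ∀ S v → Dec (Ready S v)
  ready? S v = (S v Bool.≟ false) ×-dec (degree n v ≤? received S v)

  burntNeighbours-insert : ∀ S {v} m → v < n → S v ≡ false →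
    burntNeighbours (insert S v) m ≡ burntNeighbours S m + adj m v
  burntNeighbours-insert S {v} m v<n Sv≡false = begin
    sumBelow n (λ w → adj m w * ⟦ insert S v w ⟧)
      ≡⟨ sumBelow-cong n (λ {w} _ → cong (adj m w *_) (⟦insert⟧ S w Sv≡false)) ⟩
    sumBelow n (λ w → adj m w * (⟦ S w ⟧ + δ v w))
      ≡⟨ sumBelow-cong n (λ {w} _ →
           trans (*-distribˡ-+ (adj m w) _ _) (cong (adj m w * ⟦ S w ⟧ +_) (*-comm (adj m w) _))) ⟩
    sumBelow n (λ w → adj m w * ⟦ S w ⟧ + δ v w * adj m w)
      ≡⟨ sumBelow-+ n _ _ ⟩
    burntNeighbours S m + sumBelow n (λ w → δ v w * adj m w)
      ≡⟨ cong (burntNeighbours S m +_) (sumBelow-δ n v (adj m)) ⟩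
    burntNeighbours S m + 𝟙< v n * adj m v
      ≡⟨ cong (λ i → burntNeighbours S m + i * adj m v) (𝟙<-< v<n) ⟩
    burntNeighbours S m + (adj m v + 0)
      ≡⟨ cong (burntNeighbours S m +_) (+-identityʳ (adj m v)) ⟩
    burntNeighbours S m + adj m v ∎
    where open ≡-Reasoning

  received-insert : ∀ S {v} m → v < n → S v ≡ false → received (insert S v) m ≡ received S m + adj m v
  received-insert S m v<n Sv≡false =
    cong suc (trans (cong (get c m +_) (burntNeighbours-insert S m v<n Sv≡false)) (sym (+-assoc (get c m) _ _)))

  received-≤-insert : ∀ S {v} m → v < n → S v ≡ false → received S m ≤ received (insert S v) m
  received-≤-insert S m v<n Sv≡false = ≤-trans (m≤m+n _ _) (≤-reflexive (sym (received-insert S m v<n Sv≡false)))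

  state-balance : ∀ {S} → LegallyToppled S → ∀ {m} → m < n → get (state S) m + ⟦ S m ⟧ * degree n m ≡ received S m
  state-balance {S} legal {m} m<n
    rewrite get-tabulate n (λ m → received S m ∸ ⟦ S m ⟧ * degree n m) m<n with S m in Sm≡b
  ... | true  = m∸n+n≡m (subst (_≤ received S m) (sym (*-identityˡ (degree n m))) (legal m<n Sm≡b))
  ... | false = +-identityʳ (received S m)

  insert-legal : ∀ {S} (k : Fin n) → Ready S (toℕ k) → LegallyToppled S → LegallyToppled (insert S (toℕ k))
  insert-legal {S} k (Sk≡false , unstable) legal {m} m<n with m ≟ toℕ k
  ... | yes refl = λ _ → ≤-trans unstable (received-≤-insert S m (toℕ<n k) Sk≡false)
  ... | no  _    = λ Sm≡true → ≤-trans (legal m<n Sm≡true) (received-≤-insert S m (toℕ<n k) Sk≡false)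

  state-unstable : ∀ {S} (k : Fin n) → Ready S (toℕ k) → deg k ≤ lookup (state S) k
  state-unstable {S} k (Sk≡false , unstable) = begin
    deg k                                 ≡⟨ deg≡degree k ⟩
    degree n v                            ≤⟨ unstable ⟩
    received S v                          ≡⟨ cong (λ b → received S v ∸ ⟦ b ⟧ * degree n v) Sk≡false ⟨
    received S v ∸ ⟦ S v ⟧ * degree n v   ≡⟨ lookup∘tabulate _ k ⟨
    lookup (state S) k                    ∎
    where
    open ≤-Reasoning
    v = toℕ k

  topple-state : ∀ {S} (k : Fin n) → Ready S (toℕ k) → LegallyToppled S →
    topple k (state S) ≡ state (insert S (toℕ k))
  topple-state {S} k ready@(Sk≡false , _) legal = get-ext _ _ λ {m} m<n → +-cancelʳ-≡ _ _ _ (begin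
    get (topple k (state S)) m + (toppled m + δ v m * deg k)  ≡⟨ +-assoc (get (topple k (state S)) m) (toppled m) _ ⟨
    get (topple k (state S)) m + toppled m + δ v m * deg k
      ≡⟨ x+y+z≡x+z+y (get (topple k (state S)) m) (toppled m) _ ⟩
    get (topple k (state S)) m + δ v m * deg k + toppled m
      ≡⟨ cong (_+ toppled m) (topple-get k (state S) unstable m<n) ⟩
    get (state S) m + adj v m + toppled m                     ≡⟨ x+y+z≡x+z+y (get (state S) m) (adj v m) _ ⟩
    get (state S) m + toppled m + adj v m                     ≡⟨ cong₂ _+_ (state-balance legal m<n) (adj-comm v m) ⟩
    received S m + adj m v                                    ≡⟨ received-insert S m (toℕ<n k) Sk≡false ⟨
    received S′ m                                             ≡⟨ state-balance (insert-legal k ready legal) m<n ⟨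
    get (state S′) m + ⟦ S′ m ⟧ * degree n m                  ≡⟨ cong (get (state S′) m +_) (toppled-insert m) ⟩
    get (state S′) m + (toppled m + δ v m * deg k)            ∎)
    where
    open ≡-Reasoning
    v = toℕ k
    unstable = state-unstable k ready
    S′ = insert S v
    toppled : ℕ → ℕ
    toppled m = ⟦ S m ⟧ * degree n m
    toppled-insert : ∀ m → ⟦ S′ m ⟧ * degree n m ≡ toppled m + δ v m * deg k
    toppled-insert m = begin
      ⟦ S′ m ⟧ * degree n m                       ≡⟨ cong (_* degree n m) (⟦insert⟧ S m Sk≡false) ⟩
      (⟦ S m ⟧ + δ v m) * degree n m              ≡⟨ *-distribʳ-+ (degree n m) ⟦ S m ⟧ (δ v m) ⟩
      toppled m + δ v m * degree n m              ≡⟨ cong (toppled m +_) (δ-* v m (degree n)) ⟨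
      toppled m + δ v m * degree n v              ≡⟨ cong (λ d → toppled m + δ v m * d) (deg≡degree k) ⟨
      toppled m + δ v m * deg k                   ∎

  state-nothing-burnt : state (λ _ → false) ≡ c ⊕ replicate n 1
  state-nothing-burnt = get-ext _ _ λ {m} m<n → begin
    get (state (λ _ → false)) m                    ≡⟨ get-tabulate n (λ m → received (λ _ → false) m ∸ 0) m<n ⟩
    suc (get c m + burntNeighbours (λ _ → false) m) ≡⟨ cong (λ x → suc (get c m + x)) none ⟩
    suc (get c m + 0)                              ≡⟨ cong suc (+-identityʳ (get c m)) ⟩
    suc (get c m)                                  ≡⟨ +-comm 1 (get c m) ⟩
    get c m + 1                                    ≡⟨ cong (get c m +_) (get-replicate n 1 m<n) ⟨
    get c m + get (replicate n 1) m                ≡⟨ get-⊕ c (replicate n 1) m<n ⟨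
    get (c ⊕ replicate n 1) m                      ∎
    where
    open ≡-Reasoning
    none : ∀ {m} → burntNeighbours (λ _ → false) m ≡ 0
    none {m} = trans (sumBelow-cong n (λ {v} _ → *-zeroʳ (adj m v))) (sumBelow-zero n)

  state-all-burnt : ∀ {S} → (∀ {m} → m < n → S m ≡ true) → state S ≡ c
  state-all-burnt {S} all-burnt = get-ext _ _ λ {m} m<n → begin
    get (state S) m
      ≡⟨ get-tabulate n (λ m → received S m ∸ ⟦ S m ⟧ * degree n m) m<n ⟩
    received S m ∸ ⟦ S m ⟧ * degree n m
      ≡⟨ cong (λ b → received S m ∸ ⟦ b ⟧ * degree n m) (all-burnt m<n) ⟩
    received S m ∸ 1 * degree n m                         ≡⟨ cong₂ _∸_ (received-all m<n) (*-identityˡ (degree n m)) ⟩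
    get c m + degree n m ∸ degree n m                     ≡⟨ m+n∸n≡m (get c m) (degree n m) ⟩
    get c m                                               ∎
    where
    open ≡-Reasoning
    received-all : ∀ {m} → m < n → received S m ≡ get c m + degree n m
    received-all {m} m<n = begin
      suc (get c m + burntNeighbours S m) ≡⟨ cong (λ x → suc (get c m + x)) (sumBelow-cong n all-count) ⟩
      suc (get c m + sumBelow n (adj m))   ≡⟨ cong (λ x → suc (get c m + x)) (sumBelow-adj n m<n) ⟩
      suc (get c m + (𝟙< 0 m + 𝟙< (suc m) n)) ≡⟨ +-suc (get c m) _ ⟨
      get c m + degree n m                 ∎
      where
      all-count : ∀ {v} → v < n → adj m v * ⟦ S v ⟧ ≡ adj m v
      all-count {v} v<n = trans (cong (λ b → adj m v * ⟦ b ⟧) (all-burnt v<n)) (*-identityʳ (adj m v))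

  burntNeighbours-closed : ∀ S {m} → m < n →
    burntNeighbours S m ≡ 𝟙< 0 m * ⟦ S (pred m) ⟧ + 𝟙< (suc m) n * ⟦ S (suc m) ⟧
  burntNeighbours-closed S = sumBelow-adj-* n (λ v → ⟦ S v ⟧)

  not-ready-bound : ∀ {S v} → v < n → S v ≡ false → ¬ Ready S v →
    get c v + (𝟙< 0 v * ⟦ S (pred v) ⟧ + 𝟙< (suc v) n * ⟦ S (suc v) ⟧) < 𝟙< 0 v + 𝟙< (suc v) n
  not-ready-bound {S} {v} v<n Sv≡false ¬ready =
    subst (λ x → get c v + x < 𝟙< 0 v + 𝟙< (suc v) n) (burntNeighbours-closed S v<n)
      (s≤s⁻¹ (≰⇒> (λ unstable → ¬ready (Sv≡false , unstable))))

  empty-at-left-end : ∀ {S v} → v < n → S v ≡ false → ¬ Ready S v → v ≡ 0 ⊎ S (pred v) ≡ true → get c v ≡ 0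
  empty-at-left-end {S} {v} v<n Sv≡false ¬ready left-edge =
    n≤0⇒n≡0 (s≤s⁻¹ (≤-trans (x+[p+q]<p+r⇒x<r (get c v) (𝟙< 0 v) q (𝟙< (suc v) n) bound) (𝟙<-≤1 (suc v) n)))
    where
    q = 𝟙< (suc v) n * ⟦ S (suc v) ⟧
    bound : get c v + (𝟙< 0 v + q) < 𝟙< 0 v + 𝟙< (suc v) n
    bound = subst (λ x → get c v + (x + q) < 𝟙< 0 v + 𝟙< (suc v) n)
      (left-edge-term S left-edge) (not-ready-bound v<n Sv≡false ¬ready)

  empty-at-right-end : ∀ {S v} → v < n → S v ≡ false → ¬ Ready S v → suc v ≡ n ⊎ S (suc v) ≡ true → get c v ≡ 0
  empty-at-right-end {S} {v} v<n Sv≡false ¬ready right-edge =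
    n≤0⇒n≡0 (s≤s⁻¹ (≤-trans (x+[p+q]<p+r⇒x<r (get c v) (𝟙< (suc v) n) q (𝟙< 0 v) bound) (𝟙<-≤1 0 v)))
    where
    q = 𝟙< 0 v * ⟦ S (pred v) ⟧
    bound : get c v + (𝟙< (suc v) n + q) < 𝟙< (suc v) n + 𝟙< 0 v
    bound = subst₂ (λ x y → get c v + x < y) (+-comm q _) (+-comm (𝟙< 0 v) _)
      (subst (λ x → get c v + (q + x) < 𝟙< 0 v + 𝟙< (suc v) n)
        (right-edge-term S right-edge) (not-ready-bound v<n Sv≡false ¬ready))

  not-ready-≤1 : ∀ {S v} → v < n → S v ≡ false → ¬ Ready S v → get c v ≤ 1
  not-ready-≤1 {v = v} v<n Sv≡false ¬ready =
    s≤s⁻¹ (<-≤-trans (≤-<-trans (m≤m+n (get c v) _) (not-ready-bound v<n Sv≡false ¬ready))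
      (+-mono-≤ (𝟙<-≤1 0 v) (𝟙<-≤1 (suc v) n)))

  not-ready-isolated : ∀ {S v} → v < n → S v ≡ false → ¬ Ready S v →
    v ≡ 0 ⊎ S (pred v) ≡ true → suc v ≡ n ⊎ S (suc v) ≡ true → ⊥
  not-ready-isolated {S} {v} v<n Sv≡false ¬ready left-edge right-edge =
    m+n≮n (get c v) (𝟙< 0 v + 𝟙< (suc v) n)
      (subst (λ x → get c v + x < 𝟙< 0 v + 𝟙< (suc v) n)
        (cong₂ _+_ (left-edge-term S left-edge) (right-edge-term S right-edge))
        (not-ready-bound v<n Sv≡false ¬ready))

  -- A maximal run [a, b] of unburnt vertices, none of them ready, is a forbidden interval.
  stuck : NoForbiddenInterval n (get c) → ∀ {S u} → u < n → S u ≡ false → (∀ {v} → v < n → ¬ Ready S v) → ⊥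
  stuck no-fi {S} {u} u<n Su≡false none-ready
    with a , a≤u , runˡ , left-edge ← run-start S Su≡false
       | b , u≤b , b<n , runʳ , right-edge ← run-end S (n ∸ suc u) (m+[n∸m]≡n u<n) Su≡false
       = refute (a ≟ b)
    where
    unburnt : ∀ {v} → a ≤ v → v ≤ b → S v ≡ false
    unburnt {v} a≤v v≤b with v ≤? u
    ... | yes v≤u = runˡ a≤v v≤u
    ... | no  v≰u = runʳ (<⇒≤ (≰⇒> v≰u)) v≤b

    a≤b = ≤-trans a≤u u≤b
    a<n = ≤-<-trans a≤b b<n

    refute : Dec (a ≡ b) → ⊥
    refute (yes refl) = not-ready-isolated b<n (unburnt a≤b ≤-refl) (none-ready b<n) left-edge right-edge
    refute (no a≢b)   = no-fi b<n (forbidden (≤∧≢⇒< a≤b a≢b)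
      (empty-at-left-end a<n (unburnt ≤-refl a≤b) (none-ready a<n) left-edge)
      (empty-at-right-end b<n (unburnt a≤b ≤-refl) (none-ready b<n) right-edge)
      λ a<v v<b → not-ready-≤1 (<-trans v<b b<n) (unburnt (<⇒≤ a<v) (<⇒≤ v<b)) (none-ready (<-trans v<b b<n)))

  burning-from : NoForbiddenInterval n (get c) → ∀ S → LegallyToppled S →
    ∀ {x} → x ≡ state S → Acc (flip (Plus ToppleStep)) x → Star ToppleStep x c
  burning-from no-fi S legal refl (acc more) with any? (λ k → ready? S (toℕ k))
  ... | yes (k , ready) = step ◅ burning-from no-fi (insert S (toℕ k)) (insert-legal k ready legal)
                                   (topple-state k ready legal) (more [ step ])
    where
    step = topples k (state-unstable k ready)
  ... | no none-ready with anyUpTo? (λ u → S u Bool.≟ false) n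
  ...   | yes (u , u<n , Su≡false) = ⊥-elim (stuck no-fi u<n Su≡false λ {v} v<n ready →
          none-ready (fromℕ< v<n , subst (Ready S) (sym (toℕ-fromℕ< v<n)) ready))
  ...   | no  all-burnt = subst (Star ToppleStep (state S))
          (state-all-burnt λ {u} u<n → ¬-not λ Su≡false → all-burnt (u , u<n , Su≡false)) ε

  burning : NoForbiddenInterval n (get c) → Star ToppleStep (c ⊕ replicate n 1) c
  burning no-fi = burning-from no-fi (λ _ → false) (λ _ ()) (sym state-nothing-burnt) (toppling-terminates _)

-- Recurrent configurations

chain-stable : {x y : Config n} → Star ChainStep x y → Stable x → Stable y
chain-stable ε                               x-stable = x-stable
chain-stable ((_ , _ , _ , y-stable) ◅ steps) _        = chain-stable steps y-stable

-- Values of maxStable are at most 2, so c + 𝟏 + 𝟏 is maxStable plus grains: burn twice.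
chain-from-maxStable : {c : Config n} → Stable c → NoForbiddenInterval n (get c) → Star ChainStep maxStable c
chain-from-maxStable {n} {c} c-stable no-fi = chain-⊕ extra maxStable-stable
  (subst (λ x → Stabilises x c) (sym max+extra≡c+1+1) (topplings-⊕ 𝟏 (burning no-fi) ◅◅ burning no-fi , c-stable))
  where
  open Burning c using (burning)
  𝟏 : Config n
  𝟏 = replicate n 1
  extra : Config n
  extra = tabulate ((λ m → (get c m + 2) ∸ (degree n m ∸ 1)) ∘ toℕ)
  max+extra≡c+1+1 : maxStable ⊕ extra ≡ c ⊕ 𝟏 ⊕ 𝟏
  max+extra≡c+1+1 = get-ext _ _ λ {m} m<n → begin
    get (maxStable ⊕ extra) m
      ≡⟨ get-⊕ maxStable extra m<n ⟩
    get (maxStable {n}) m + get extra m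
      ≡⟨ cong₂ _+_ (get-tabulate n (λ m → degree n m ∸ 1) m<n) (get-tabulate n (λ m → _ ∸ (degree n m ∸ 1)) m<n) ⟩
    (degree n m ∸ 1) + ((get c m + 2) ∸ (degree n m ∸ 1))
      ≡⟨ m+[n∸m]≡n (≤-trans (degree-1≤2 m) (m≤n+m 2 _)) ⟩
    get c m + 2
      ≡⟨ +-assoc (get c m) 1 1 ⟨
    get c m + 1 + 1
      ≡⟨ cong₂ (λ x y → get c m + x + y) (get-replicate n 1 m<n) (get-replicate n 1 m<n) ⟨
    get c m + get 𝟏 m + get 𝟏 m
      ≡⟨ cong (_+ get 𝟏 m) (get-⊕ c 𝟏 m<n) ⟨
    get (c ⊕ 𝟏) m + get 𝟏 m
      ≡⟨ get-⊕ (c ⊕ 𝟏) 𝟏 m<n ⟨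
    get (c ⊕ 𝟏 ⊕ 𝟏) m ∎
    where
    open ≡-Reasoning
    degree-1≤2 : ∀ m → degree n m ∸ 1 ≤ 2
    degree-1≤2 m = +-mono-≤ (𝟙<-≤1 0 m) (𝟙<-≤1 (suc m) n)

recurrent⇒noForbidden : {c : Config n} → Recurrent c → NoForbiddenInterval n (get c)
recurrent⇒noForbidden (c-stable , returns) =
  noForbidden-chain (returns maxStable (chain-to-maxStable c-stable)) noForbidden-maxStable

stable×noForbidden⇒recurrent : {c : Config n} → Stable c → NoForbiddenInterval n (get c) → Recurrent c
stable×noForbidden⇒recurrent c-stable no-fi =
  c-stable , λ d c→d → chain-to-maxStable (chain-stable c→d c-stable) ◅◅ chain-from-maxStable c-stable no-fi

NoForbiddenList : List ℕ → Set
NoForbiddenList xs = NoForbiddenInterval (length xs) (xs ‼_)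

TailStable : List ℕ → Set
TailStable ys = ∀ {m} → m < length ys → ys ‼ m < degree (suc (length ys)) (suc m)

NoPending : List ℕ → Set
NoPending ys = ∀ {b} → b < length ys → ¬ ForbiddenInterval ((0 ∷ ys) ‼_) 0 (suc b)

forbidden-∷⁻ : ∀ {x ys a b} → ForbiddenInterval ((x ∷ ys) ‼_) (suc a) (suc b) → ForbiddenInterval (ys ‼_) a b
forbidden-∷⁻ (forbidden a<b left right inner) =
  forbidden (s≤s⁻¹ a<b) left right λ a<v v<b → inner (s≤s a<v) (s≤s v<b)

forbidden-∷⁺ : ∀ {x ys a b} → ForbiddenInterval (ys ‼_) a b → ForbiddenInterval ((x ∷ ys) ‼_) (suc a) (suc b)
forbidden-∷⁺ (forbidden a<b left right inner) = forbidden (s≤s a<b) left right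
  λ { {suc v} (s≤s a<v) (s≤s v<b) → inner a<v v<b }

noForbidden-tail : ∀ {x ys} → NoForbiddenList (x ∷ ys) → NoForbiddenList ys
noForbidden-tail no-fi b<n fi = no-fi (s≤s b<n) (forbidden-∷⁺ fi)

noForbidden-0∷ : ∀ {ys} → NoForbiddenList (0 ∷ ys) → NoPending ys
noForbidden-0∷ no-fi b<n fi = no-fi (s≤s b<n) fi

noForbidden-∷⁺ : ∀ {x ys} → NoForbiddenList ys → (x ≡ 0 → NoPending ys) → NoForbiddenList (x ∷ ys)
noForbidden-∷⁺ no-fi no-pending {zero}  {zero}  _         fi = <-irrefl refl (ForbiddenInterval.a<b fi)
noForbidden-∷⁺ no-fi no-pending {zero}  {suc b} (s≤s b<n) fi@(forbidden _ refl _ _) = no-pending refl b<n fi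
noForbidden-∷⁺ no-fi no-pending {suc a} {zero}  _         fi = ≤⇒≯ z≤n (ForbiddenInterval.a<b fi)
noForbidden-∷⁺ no-fi no-pending {suc a} {suc b} (s≤s b<n) fi = no-fi b<n (forbidden-∷⁻ fi)

noForbidden-[_] : ∀ x → NoForbiddenList (x ∷ [])
noForbidden-[ x ] {b = zero}  _               fi = ≤⇒≯ z≤n (ForbiddenInterval.a<b fi)
noForbidden-[ x ] {b = suc b} (s≤s ())

noPending-1∷⁻ : ∀ {ys} → NoPending (1 ∷ ys) → NoPending ys
noPending-1∷⁻ no-pending b<n (forbidden _ left right inner) =
  no-pending (s≤s b<n) (forbidden z<s left right
    λ { {suc zero}    _ _              → ≤-refl
      ; {suc (suc v)} _ (s≤s v+1<b+1) → inner z<s v+1<b+1 })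

noPending-1∷⁺ : ∀ {ys} → NoPending ys → NoPending (1 ∷ ys)
noPending-1∷⁺ no-pending {zero}  _         (forbidden _ _ () _)
noPending-1∷⁺ no-pending {suc b} (s≤s b<n) (forbidden _ left right inner) =
  no-pending b<n (forbidden z<s left right
    λ { {suc v} _ (s≤s v<b) → inner z<s (s≤s (s≤s v<b)) })

-- Admissible d (c_i ∷ ⋯ ∷ c_n), for i ≥ 2, follows the rules of Φ_F from an edge {i-1, i} oriented d;
-- the orientation `up` records that a 0 followed only by 1s precedes vertex i.
data Admissible : Dir → List ℕ → Set where
  last-0 : Admissible down (0 ∷ [])
  last-1 : ∀ {d} → Admissible d (1 ∷ [])
  cons-0 : ∀ {y ys} → Admissible up (y ∷ ys) → Admissible down (0 ∷ y ∷ ys)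
  cons-1 : ∀ {d y ys} → Admissible d (y ∷ ys) → Admissible d (1 ∷ y ∷ ys)
  cons-2 : ∀ {d y ys} → Admissible down (y ∷ ys) → Admissible d (2 ∷ y ∷ ys)

data RecurrentList : List ℕ → Set where
  single  : RecurrentList (0 ∷ [])
  first-0 : ∀ {y ys} → Admissible up (y ∷ ys) → RecurrentList (0 ∷ y ∷ ys)
  first-1 : ∀ {y ys} → Admissible down (y ∷ ys) → RecurrentList (1 ∷ y ∷ ys)

tailStable-[_] : ∀ {x} → x ≤ 1 → TailStable (x ∷ [])
tailStable-[ x≤1 ] {zero}  _         = s≤s x≤1
tailStable-[ x≤1 ] {suc m} (s≤s ())

tailStable-∷ : ∀ {x y ys} → x ≤ 2 → TailStable (y ∷ ys) → TailStable (x ∷ y ∷ ys)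
tailStable-∷ x≤2 stable {zero}  _         = s≤s x≤2
tailStable-∷ x≤2 stable {suc m} (s≤s m<n) = stable m<n

admissible⇒ : ∀ {d ys} → Admissible d ys → TailStable ys × NoForbiddenList ys × (d ≡ up → NoPending ys)
admissible⇒ last-0 = tailStable-[ z≤n ] , noForbidden-[ 0 ] , λ ()
admissible⇒ last-1 = tailStable-[ s≤s z≤n ] , noForbidden-[ 1 ]
  , λ { refl {zero} _ (forbidden _ _ () _) ; refl {suc _} (s≤s ()) }
admissible⇒ (cons-0 adm) with stable , no-fi , no-pending ← admissible⇒ adm =
  tailStable-∷ z≤n stable , noForbidden-∷⁺ no-fi (λ _ → no-pending refl) , λ ()
admissible⇒ (cons-1 adm) with stable , no-fi , no-pending ← admissible⇒ adm =
  tailStable-∷ (s≤s z≤n) stable , noForbidden-∷⁺ no-fi (λ ()) , noPending-1∷⁺ ∘ no-pending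
admissible⇒ (cons-2 adm) with stable , no-fi , _ ← admissible⇒ adm =
  tailStable-∷ ≤-refl stable , noForbidden-∷⁺ no-fi (λ ())
  , λ { refl {zero} _ (forbidden _ _ () _) ; refl {suc b} _ fi → 1+n≰n (ForbiddenInterval.inner≤1 fi z<s (s≤s z<s)) }

forbidden-00 : ∀ {ys} → ForbiddenInterval ((0 ∷ 0 ∷ ys) ‼_) 0 1
forbidden-00 = forbidden z<s refl refl λ { {suc _} _ (s≤s ()) }

tailStable-∷⁻ : ∀ {x ys} → TailStable (x ∷ ys) → TailStable ys
tailStable-∷⁻ stable m<n = stable (s≤s m<n)

admissible⇐ : ∀ d {y ys} → TailStable (y ∷ ys) → NoForbiddenList (y ∷ ys) → (d ≡ up → NoPending (y ∷ ys)) →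
  Admissible d (y ∷ ys)
admissible⇐ down {0}       {[]} _ _ _          = last-0
admissible⇐ up   {0}       {[]} _ _ no-pending = ⊥-elim (no-pending refl z<s forbidden-00)
admissible⇐ d    {1}       {[]} _ _ _          = last-1
admissible⇐ d    {suc (suc _)} {[]} stable _ _ with s≤s (s≤s ()) ← stable z<s
admissible⇐ down {0}       {_ ∷ _} stable no-fi _ =
  cons-0 (admissible⇐ up (tailStable-∷⁻ stable) (noForbidden-tail no-fi) λ _ → noForbidden-0∷ no-fi)
admissible⇐ up   {0}       {_ ∷ _} _ _ no-pending = ⊥-elim (no-pending refl z<s forbidden-00)
admissible⇐ d    {1}       {_ ∷ _} stable no-fi no-pending =
  cons-1 (admissible⇐ d (tailStable-∷⁻ stable) (noForbidden-tail no-fi) (noPending-1∷⁻ ∘ no-pending))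
admissible⇐ d    {2}       {_ ∷ _} stable no-fi _ =
  cons-2 (admissible⇐ down (tailStable-∷⁻ stable) (noForbidden-tail no-fi) λ ())
admissible⇐ d    {suc (suc (suc _))} {_ ∷ _} stable _ _ with s≤s (s≤s (s≤s ())) ← stable z<s

stableValues-∷ : ∀ {x ys} → x < degree (suc (length ys)) 0 → TailStable ys →
  StableValues (length (x ∷ ys)) ((x ∷ ys) ‼_)
stableValues-∷ x<deg _      {zero}  _         = x<deg
stableValues-∷ _     stable {suc m} (s≤s m<n) = stable m<n

recurrentList⇒ : ∀ {xs} → RecurrentList xs → StableValues (length xs) (xs ‼_) × NoForbiddenList xs
recurrentList⇒ single = stableValues-∷ {0} {[]} ≤-refl (λ ()) , noForbidden-[ 0 ]
recurrentList⇒ (first-0 {y} {ys} adm) with stable , no-fi , no-pending ← admissible⇒ adm =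
  stableValues-∷ {0} {y ∷ ys} z<s stable , noForbidden-∷⁺ no-fi (λ _ → no-pending refl)
recurrentList⇒ (first-1 {y} {ys} adm) with stable , no-fi , _ ← admissible⇒ adm =
  stableValues-∷ {1} {y ∷ ys} ≤-refl stable , noForbidden-∷⁺ no-fi (λ ())

stableValues-∷⁻ : ∀ {x ys} → StableValues (length (x ∷ ys)) ((x ∷ ys) ‼_) → TailStable ys
stableValues-∷⁻ stable m<n = stable (s≤s m<n)

recurrentList⇐ : ∀ {x ys} → StableValues (length (x ∷ ys)) ((x ∷ ys) ‼_) → NoForbiddenList (x ∷ ys) →
  RecurrentList (x ∷ ys)
recurrentList⇐ {0}     {[]}    _ _ = single
recurrentList⇐ {suc _} {[]}    stable _ with s≤s () ← stable z<s
recurrentList⇐ {0}     {_ ∷ _} stable no-fi =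
  first-0 (admissible⇐ up (stableValues-∷⁻ stable) (noForbidden-tail no-fi) λ _ → noForbidden-0∷ no-fi)
recurrentList⇐ {1}     {_ ∷ _} stable no-fi =
  first-1 (admissible⇐ down (stableValues-∷⁻ stable) (noForbidden-tail no-fi) λ ())
recurrentList⇐ {suc (suc _)} {_ ∷ _} stable _ with s≤s (s≤s ()) ← stable z<s

-- The map Φ_F

-- wordFrom d (c_i ∷ ⋯ ∷ c_n) = w_{i-1} ⋯ w_{n-1} when {i-1, i} is oriented d
wordFrom : Dir → List ℕ → List Letter
wordFrom d []       = []
wordFrom d (y ∷ ys) = letterFor d y ys ∷ phiAux d (y ∷ ys)

dirOf : Letter → Dir
dirOf R  = up
dirOf Lu = down
dirOf Lm = down

dirOf-markLetter : ∀ b y → dirOf (markLetter b y) ≡ down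
dirOf-markLetter true  y with y ≟ 1
... | yes _ = refl
... | no  _ = refl
dirOf-markLetter false y with y ≟ 2
... | yes _ = refl
... | no  _ = refl

dirOf-letterFor : ∀ d y ys → dirOf (letterFor d y ys) ≡ d
dirOf-letterFor up   y ys = refl
dirOf-letterFor down y ys = dirOf-markLetter (isLast ys) y

properlyMarked-Lm∷ : ∀ {l w} → dirOf l ≡ down → ProperlyMarked (l ∷ w) → ProperlyMarked (Lm ∷ l ∷ w)
properlyMarked-Lm∷ {Lu} _ pm = pm-LmLu pm
properlyMarked-Lm∷ {Lm} _ pm = pm-LmLm pm

properlyMarked-tail : ∀ {l w} → ProperlyMarked (l ∷ w) → ProperlyMarked w
properlyMarked-tail (pm-Lu pm)   = pm
properlyMarked-tail (pm-R pm)    = pm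
properlyMarked-tail pm-Lm        = pm-[]
properlyMarked-tail (pm-LmLu pm) = pm
properlyMarked-tail (pm-LmLm pm) = pm

admissible⇒properlyMarked : ∀ {d ys} → Admissible d ys → ProperlyMarked (wordFrom d ys)
admissible⇒properlyMarked last-0              = pm-Lu pm-[]
admissible⇒properlyMarked (last-1 {up})       = pm-R pm-[]
admissible⇒properlyMarked (last-1 {down})     = pm-Lm
admissible⇒properlyMarked (cons-0 adm)        = pm-Lu (admissible⇒properlyMarked adm)
admissible⇒properlyMarked (cons-1 {up} adm)   = pm-R (admissible⇒properlyMarked adm)
admissible⇒properlyMarked (cons-1 {down} adm) = pm-Lu (admissible⇒properlyMarked adm)
admissible⇒properlyMarked (cons-2 {up} adm)   = pm-R (admissible⇒properlyMarked adm)
admissible⇒properlyMarked (cons-2 {down} {y} {ys} adm) =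
  properlyMarked-Lm∷ (dirOf-letterFor down y ys) (admissible⇒properlyMarked adm)

recurrentList⇒properlyMarked : ∀ {xs} → RecurrentList xs → ProperlyMarked (phiAux down xs)
recurrentList⇒properlyMarked single        = pm-[]
recurrentList⇒properlyMarked (first-0 adm) = admissible⇒properlyMarked adm
recurrentList⇒properlyMarked (first-1 adm) = admissible⇒properlyMarked adm

length-phiAux : ∀ d xs → length (phiAux d xs) ≡ length xs ∸ 1
length-phiAux d []           = refl
length-phiAux d (x ∷ [])     = refl
length-phiAux d (x ∷ y ∷ ys) = cong suc (length-phiAux (nextDir d x) (y ∷ ys))

isDown : Dir → ℕ
isDown down = 1
isDown up   = 0

markedCount-cons : ∀ k x e e′ {m L S} → k + 1 + e′ ≡ x + e → m + L ≡ S + e′ → k + m + suc L ≡ x + S + e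
markedCount-cons k x e e′ {m} {L} {S} vertex rest = begin
  k + m + suc L        ≡⟨ regroup k m L ⟩
  k + 1 + (m + L)      ≡⟨ cong (k + 1 +_) rest ⟩
  k + 1 + (S + e′)     ≡⟨ reorder k S e′ ⟩
  k + 1 + e′ + S       ≡⟨ cong (_+ S) vertex ⟩
  x + e + S            ≡⟨ x+y+z≡x+z+y x e S ⟩
  x + S + e            ∎
  where
  open ≡-Reasoning
  regroup : ∀ k m L → k + m + suc L ≡ k + 1 + (m + L)
  regroup = solve-∀
  reorder : ∀ k S e′ → k + 1 + (S + e′) ≡ k + 1 + e′ + S
  reorder = solve-∀

markedCount-wordFrom : ∀ {d ys} → Admissible d ys → markedCount (wordFrom d ys) + length ys ≡ sum ys + isDown d
markedCount-wordFrom last-0                = refl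
markedCount-wordFrom (last-1 {up})         = refl
markedCount-wordFrom (last-1 {down})       = refl
markedCount-wordFrom (cons-0 adm)          = markedCount-cons 0 0 1 0 refl (markedCount-wordFrom adm)
markedCount-wordFrom (cons-1 {up} adm)     = markedCount-cons 0 1 0 0 refl (markedCount-wordFrom adm)
markedCount-wordFrom (cons-1 {down} adm)   = markedCount-cons 0 1 1 1 refl (markedCount-wordFrom adm)
markedCount-wordFrom (cons-2 {up} adm)     = markedCount-cons 0 2 0 1 refl (markedCount-wordFrom adm)
markedCount-wordFrom (cons-2 {down} adm)   = markedCount-cons 1 2 1 1 refl (markedCount-wordFrom adm)

markedCount-phiAux : ∀ {xs} → RecurrentList xs → markedCount (phiAux down xs) + length xs ≡ sum xs + 1
markedCount-phiAux single        = refl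
markedCount-phiAux (first-0 adm) = markedCount-cons 0 0 1 0 refl (markedCount-wordFrom adm)
markedCount-phiAux (first-1 adm) = markedCount-cons 0 1 1 1 refl (markedCount-wordFrom adm)

-- c_i, read off w_{i-1} and the orientation of {i, i+1}
vertexValue : Letter → Dir → ℕ
vertexValue R  up   = 1
vertexValue R  down = 2
vertexValue Lu up   = 0
vertexValue Lu down = 1
vertexValue Lm _    = 2

lastValue : Letter → ℕ
lastValue R  = 1
lastValue Lu = 0
lastValue Lm = 1

firstValue : Dir → ℕ
firstValue up   = 0
firstValue down = 1

-- decodeFrom w_{i-1} (w_i ⋯ w_{n-1}) = c_i ⋯ c_n
decodeFrom : Letter → List Letter → List ℕ
decodeFrom a []      = lastValue a ∷ []
decodeFrom a (b ∷ w) = vertexValue a (dirOf b) ∷ decodeFrom b w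

decode : List Letter → List ℕ
decode []      = 0 ∷ []
decode (b ∷ w) = firstValue (dirOf b) ∷ decodeFrom b w

length-decode : ∀ w → length (decode w) ≡ suc (length w)
length-decode []      = refl
length-decode (b ∷ w) = cong suc (length-decodeFrom b w)
  where
  length-decodeFrom : ∀ a w → length (decodeFrom a w) ≡ suc (length w)
  length-decodeFrom a []      = refl
  length-decodeFrom a (b ∷ w) = cong suc (length-decodeFrom b w)

decodeFrom-wordFrom : ∀ {d y ys} → Admissible d (y ∷ ys) → decodeFrom (letterFor d y ys) (phiAux d (y ∷ ys)) ≡ y ∷ ys
decodeFrom-wordFrom last-0                = refl
decodeFrom-wordFrom (last-1 {up})         = refl
decodeFrom-wordFrom (last-1 {down})       = refl
decodeFrom-wordFrom (cons-0 adm)          = cong (0 ∷_) (decodeFrom-wordFrom adm)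
decodeFrom-wordFrom (cons-1 {up} adm)     = cong (1 ∷_) (decodeFrom-wordFrom adm)
decodeFrom-wordFrom (cons-1 {down} {y} {ys} adm)
  rewrite dirOf-letterFor down y ys = cong (1 ∷_) (decodeFrom-wordFrom adm)
decodeFrom-wordFrom (cons-2 {up} {y} {ys} adm)
  rewrite dirOf-letterFor down y ys = cong (2 ∷_) (decodeFrom-wordFrom adm)
decodeFrom-wordFrom (cons-2 {down} adm)   = cong (2 ∷_) (decodeFrom-wordFrom adm)

decode-phiAux : ∀ {xs} → RecurrentList xs → decode (phiAux down xs) ≡ xs
decode-phiAux single                    = refl
decode-phiAux (first-0 adm)             = cong (0 ∷_) (decodeFrom-wordFrom adm)
decode-phiAux (first-1 {y} {ys} adm) rewrite dirOf-letterFor down y ys = cong (1 ∷_) (decodeFrom-wordFrom adm)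

decodeFrom-admissible : ∀ a w → ProperlyMarked (a ∷ w) →
  Admissible (dirOf a) (decodeFrom a w) × wordFrom (dirOf a) (decodeFrom a w) ≡ a ∷ w
decodeFrom-admissible R  [] _ = last-1 , refl
decodeFrom-admissible Lu [] _ = last-0 , refl
decodeFrom-admissible Lm [] _ = last-1 , refl
decodeFrom-admissible a (b ∷ w) pm with decodeFrom b w | decodeFrom-admissible b w (properlyMarked-tail pm)
... | y ∷ ys | adm , eq = extend a b pm adm eq
  where
  extend : ∀ a b → ProperlyMarked (a ∷ b ∷ w) → Admissible (dirOf b) (y ∷ ys) → wordFrom (dirOf b) (y ∷ ys) ≡ b ∷ w →
    Admissible (dirOf a) (vertexValue a (dirOf b) ∷ y ∷ ys)
      × wordFrom (dirOf a) (vertexValue a (dirOf b) ∷ y ∷ ys) ≡ a ∷ b ∷ w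
  extend R  R  _  adm eq = cons-1 adm , cong (R ∷_) eq
  extend R  Lu _  adm eq = cons-2 adm , cong (R ∷_) eq
  extend R  Lm _  adm eq = cons-2 adm , cong (R ∷_) eq
  extend Lu R  _  adm eq = cons-0 adm , cong (Lu ∷_) eq
  extend Lu Lu _  adm eq = cons-1 adm , cong (Lu ∷_) eq
  extend Lu Lm _  adm eq = cons-1 adm , cong (Lu ∷_) eq
  extend Lm R  () adm eq
  extend Lm Lu _  adm eq = cons-2 adm , cong (Lm ∷_) eq
  extend Lm Lm _  adm eq = cons-2 adm , cong (Lm ∷_) eq

decode-recurrentList : ∀ w → ProperlyMarked w → RecurrentList (decode w) × phiAux down (decode w) ≡ w
decode-recurrentList []      _  = single , refl
decode-recurrentList (b ∷ w) pm with decodeFrom b w | decodeFrom-admissible b w pm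
... | y ∷ ys | adm , eq = first b adm eq
  where
  first : ∀ b → Admissible (dirOf b) (y ∷ ys) → wordFrom (dirOf b) (y ∷ ys) ≡ b ∷ w →
    RecurrentList (firstValue (dirOf b) ∷ y ∷ ys) × phiAux down (firstValue (dirOf b) ∷ y ∷ ys) ≡ b ∷ w
  first R  adm eq = first-0 adm , eq
  first Lu adm eq = first-1 adm , eq
  first Lm adm eq = first-1 adm , eq

StableAndFree : Config n → ℕ → Set
StableAndFree c L = StableValues L (get c) × NoForbiddenInterval L (get c)

toList-injective : {c d : Config n} → toList c ≡ toList d → c ≡ d
toList-injective {c = c} {d} eq = get-ext c d λ {m} _ → cong (_‼ m) eq

fromList-length : ∀ xs → length xs ≡ n → Σ (Config n) λ c → toList c ≡ xs
fromList-length xs refl = fromList xs , toList∘fromList xs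

recurrent⇒recurrentList : (c : Config (suc n)) → Recurrent c → RecurrentList (toList c)
recurrent⇒recurrentList c@(_ ∷ _) rec = uncurry recurrentList⇐
  (subst (StableAndFree c) (sym (length-toList c))
    (stable⇒stableValues {c = c} (proj₁ rec) , recurrent⇒noForbidden rec))

recurrentList⇒recurrent : (c : Config (suc n)) → RecurrentList (toList c) → Recurrent c
recurrentList⇒recurrent c recList
  with stable , no-fi ← subst (StableAndFree c) (length-toList c) (recurrentList⇒ recList) =
  stable×noForbidden⇒recurrent {c = c} (stableValues⇒stable {c = c} stable) no-fi

open import Data.Integer as ℤ using (+_; _-_)
open import Data.Integer.Properties using (pos-+)
import Data.Integer.Tactic.RingSolver as ℤ-Solver

m+n≡s+1⇒[s-n]+1≡m : ∀ {s n m} → m + n ≡ s + 1 → (+ s - + n) ℤ.+ + 1 ≡ + m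
m+n≡s+1⇒[s-n]+1≡m {s} {n} {m} eq = begin
  (+ s - + n) ℤ.+ + 1   ≡⟨ rearrange (+ s) (+ n) ⟩
  (+ s ℤ.+ + 1) - + n   ≡⟨ cong (_- + n) (pos-+ s 1) ⟨
  + (s + 1) - + n       ≡⟨ cong (λ k → + k - + n) eq ⟨
  + (m + n) - + n       ≡⟨ cong (_- + n) (pos-+ m n) ⟩
  (+ m ℤ.+ + n) - + n   ≡⟨ cancel (+ m) (+ n) ⟩
  + m                   ∎
  where
  open ≡-Reasoning
  rearrange : ∀ a b → (a - b) ℤ.+ + 1 ≡ (a ℤ.+ + 1) - b
  rearrange = ℤ-Solver.solve-∀
  cancel : ∀ a b → (a ℤ.+ b) - b ≡ a
  cancel = ℤ-Solver.solve-∀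

ΦF-properlyMarked : (c : Config (suc n)) → Recurrent c → ProperlyMarked (ΦF c) × length (ΦF c) ≡ n
ΦF-properlyMarked c rec = recurrentList⇒properlyMarked (recurrent⇒recurrentList c rec)
                        , trans (length-phiAux down (toList c)) (cong (_∸ 1) (length-toList c))

ΦF-injective : (c c′ : Config (suc n)) → Recurrent c → Recurrent c′ → ΦF c ≡ ΦF c′ → c ≡ c′
ΦF-injective c c′ rec rec′ eq = toList-injective (begin
  toList c        ≡⟨ decode-phiAux (recurrent⇒recurrentList c rec) ⟨
  decode (ΦF c)   ≡⟨ cong decode eq ⟩
  decode (ΦF c′)  ≡⟨ decode-phiAux (recurrent⇒recurrentList c′ rec′) ⟩
  toList c′       ∎)
  where open ≡-Reasoning

ΦF-surjective : (w : List Letter) → ProperlyMarked w → length w ≡ n →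
  Σ (Config (suc n)) λ c → Recurrent c × ΦF c ≡ w
ΦF-surjective w pm len
  with c , toList-c≡decode ← fromList-length (decode w) (trans (length-decode w) (cong suc len))
     | recList , phi≡w ← decode-recurrentList w pm
     = c , recurrentList⇒recurrent c (subst RecurrentList (sym toList-c≡decode) recList)
         , trans (cong (phiAux down) toList-c≡decode) phi≡w

level≡markedCount : (c : Config (suc n)) → Recurrent c → level c ≡ + markedCount (ΦF c)
level≡markedCount {n} c rec = m+n≡s+1⇒[s-n]+1≡m (begin
  markedCount (ΦF c) + suc n            ≡⟨ cong (λ k → markedCount (ΦF c) + k) (length-toList c) ⟨
  markedCount (ΦF c) + length (toList c) ≡⟨ markedCount-phiAux (recurrent⇒recurrentList c rec) ⟩
  sum (toList c) + 1                     ∎)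
  where open ≡-Reasoning

theorem5p4 : (n : ℕ) → 1 ≤ n →
    ((c : Config n) → Recurrent c →
        ProperlyMarked (ΦF c) × length (ΦF c) ≡ n ∸ 1)
    × ((c c′ : Config n) → Recurrent c → Recurrent c′ → ΦF c ≡ ΦF c′ → c ≡ c′)
    × ((w : List Letter) → ProperlyMarked w → length w ≡ n ∸ 1 →
        Σ (Config n) (λ c → Recurrent c × ΦF c ≡ w))
    × ((c : Config n) → Recurrent c → level c ≡ + markedCount (ΦF c))
theorem5p4 (suc n) _ = ΦF-properlyMarked , ΦF-injective , ΦF-surjective , level≡markedCount
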